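{- Let $(W,S,*)$ be a twisted Coxeter system, let $x,y,z\in\mathcal{I}_*$ and $w\in\mathcal{A}_*(x,z)$. Then (a) if $w^*y\leq xw$ then $y\leq z$; and (b) if $w^*z\leq yw$ then $x\leq y$.
   Context: A twisted Coxeter system $(W,S,*)$ is a Coxeter system $(W,S)$ with length function $\ell$ together with an automorphism $*$ of $W$ (written $w\mapsto w^*$) satisfying $S^*=S$ and $(w^*)^*=w$. Let $\mathcal{I}_*=\{w\in W: w^{ -1}=w^*\}$. The Demazure product $\circ$ is the unique associative operation on $W$ with $s\circ w = sw$ if $\ell(sw)>\ell(w)$ and $s\circ w=w$ otherwise, and $w\circ s=ws$ if $\ell(ws)>\ell(w)$ and $w\circ s = w$ otherwise, for $s\in S$, $w\in W$. For $x,w\in W$ put $x\ltimes_* w = (w^*)^{ -1}\circ x\circ w$. For $x,z\in\mathcal{I}_*$, $\mathcal{A}_*(x,z)$ is the set of minimal-length elements of $\{w\in W: x\ltimes_* w = z\}$. $\leq$ is Bruhat order. -}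

module Defs where

open import Level using (0ℓ)
open import Algebra.Bundles using (Group)
open import Algebra.Morphism.Structures using (module GroupMorphisms)
open import Data.Nat using (ℕ; zero; suc; _≤_; _<_)
open import Data.List using (List; []; _∷_; foldr; length)
open import Data.Product using (Σ; ∃; ∃-syntax; _×_; _,_; proj₁)
open import Relation.Nullary using (¬_)
open import Relation.Binary.PropositionalEquality using (_≡_)

module _ (G : Group 0ℓ 0ℓ) where
  open Group G

  pow : Carrier → ℕ → Carrier
  pow g zero    = ε
  pow g (suc m) = g ∙ pow g m

  Word : (Carrier → Set) → Set
  Word S = List (Σ Carrier S)

  prod : {S : Carrier → Set} → Word S → Carrier
  prod = foldr (λ s acc → proj₁ s ∙ acc) ε

-- Coxeter system (W,S): W is generated by the set S of involutions and
-- has the presentation  < S | (st)^{m(s,t)} = 1 >  where m(s,t) is the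
-- order of st, expressed by the universal property of that presentation:
-- every map f from S into a group H satisfying all relations
-- (st)^m = 1 that hold in W extends to a group homomorphism W → H.

record IsCoxeterSystem (W : Group 0ℓ 0ℓ) (S : Group.Carrier W → Set) : Set₁ where
  open Group W
  field
    S-resp     : ∀ {x y} → x ≈ y → S x → S y
    S-invol    : ∀ {s} → S s → s ∙ s ≈ ε
    S-nontriv  : ∀ {s} → S s → ¬ (s ≈ ε)
    generated  : ∀ (w : Carrier) → ∃[ ws ] (prod W {S} ws ≈ w)
    universal  : (H : Group 0ℓ 0ℓ) (f : Σ Carrier S → Group.Carrier H) →
                 (∀ {s t} (ps : S s) (pt : S t) → s ≈ t →
                    Group._≈_ H (f (s , ps)) (f (t , pt))) →
                 (∀ {s t} (ps : S s) (pt : S t) (m : ℕ) →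
                    pow W (s ∙ t) m ≈ ε →
                    Group._≈_ H (pow H (Group._∙_ H (f (s , ps)) (f (t , pt))) m) (Group.ε H)) →
                 ∃[ φ ] (GroupMorphisms.IsGroupHomomorphism (Group.rawGroup W) (Group.rawGroup H) φ
                         × (∀ {s} (ps : S s) → Group._≈_ H (φ s) (f (s , ps))))

-- Twisted Coxeter system (W,S,*): * is a group automorphism of W with
-- S* = S and (w*)* = w.  (Since * is an involution, S* ⊆ S gives S* = S,
-- and * is bijective.)

record TwistedCoxeterSystem : Set₁ where
  field
    W        : Group 0ℓ 0ℓ
    S        : Group.Carrier W → Set
    isCoxeter : IsCoxeterSystem W S
  open Group W
  field
    star      : Carrier → Carrier
    star-hom  : GroupMorphisms.IsGroupHomomorphism (Group.rawGroup W) (Group.rawGroup W) star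
    star-invol : ∀ w → star (star w) ≈ w
    star-S    : ∀ {s} → S s → S (star s)

module TCS (T : TwistedCoxeterSystem) where
  open TwistedCoxeterSystem T public
  open Group W public

  record IsLengthFunction (ℓ : Carrier → ℕ) : Set where
    field
      ℓ-attained : ∀ w → ∃[ ws ] (prod W {S} ws ≈ w × length ws ≡ ℓ w)
      ℓ-minimal  : ∀ w (ws : Word W S) → prod W {S} ws ≈ w → ℓ w ≤ length ws

  Twisted : Carrier → Set
  Twisted w = w ⁻¹ ≈ star w

  record IsDemazureProduct (ℓ : Carrier → ℕ) (_⊙_ : Carrier → Carrier → Carrier) : Set where
    field
      ⊙-cong   : ∀ {a a' b b'} → a ≈ a' → b ≈ b' → (a ⊙ b) ≈ (a' ⊙ b')
      ⊙-assoc  : ∀ a b c → ((a ⊙ b) ⊙ c) ≈ (a ⊙ (b ⊙ c))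
      ⊙-left-up     : ∀ {s} w → S s → ℓ w < ℓ (s ∙ w) → (s ⊙ w) ≈ (s ∙ w)
      ⊙-left-down   : ∀ {s} w → S s → ¬ (ℓ w < ℓ (s ∙ w)) → (s ⊙ w) ≈ w
      ⊙-right-up    : ∀ {s} w → S s → ℓ w < ℓ (w ∙ s) → (w ⊙ s) ≈ (w ∙ s)
      ⊙-right-down  : ∀ {s} w → S s → ¬ (ℓ w < ℓ (w ∙ s)) → (w ⊙ s) ≈ w

  Reflection : Carrier → Set
  Reflection t = ∃[ g ] ∃[ s ] (S s × t ≈ (g ∙ s) ∙ g ⁻¹)

  data Bruhat (ℓ : Carrier → ℕ) : Carrier → Carrier → Set where
    bruhat-refl : ∀ {u w} → u ≈ w → Bruhat ℓ u w
    bruhat-step : ∀ {u v w t} → Bruhat ℓ u v → Reflection t →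
                  w ≈ v ∙ t → ℓ v < ℓ w → Bruhat ℓ u w

  -- twisted Demazure conjugation  x ⋉* w = (w*)⁻¹ ∘ x ∘ w
  twistAct : (Carrier → Carrier → Carrier) → Carrier → Carrier → Carrier
  twistAct _⊙_ x w = (((star w) ⁻¹) ⊙ x) ⊙ w

  record InA (ℓ : Carrier → ℕ) (_⊙_ : Carrier → Carrier → Carrier) (x z w : Carrier) : Set where
    field
      solves  : twistAct _⊙_ x w ≈ z
      minimal : ∀ w' → twistAct _⊙_ x w' ≈ z → ℓ w ≤ ℓ w'

module Submission where

open import Defs
open import Level using (0ℓ; _⊔_)
open import Algebra.Bundles using (Group; CommutativeRing)
open import Algebra.Morphism.Structures using (module GroupMorphisms)
open import Data.Nat using (ℕ; zero; suc; _+_; _≤_; _<_; z≤n; s≤s; s≤s⁻¹; _≟_; _<?_)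
open import Data.Nat.Properties
open import Data.Fin using (Fin; zero; suc)
open import Data.Bool using (Bool; true; false; not; _xor_)
open import Data.Bool.Properties using (xor-assoc; xor-same; xor-identityʳ; xor-comm; not-¬; xor-∧-commutativeRing)
open import Data.List using (List; []; _∷_; _++_; foldr)
open import Data.List.Properties using (length-++)
open import Data.Product using (∃-syntax; _×_; _,_; proj₁; proj₂)
open import Data.Product.Properties using (≡-dec)
open import Data.Sum using (_⊎_; inj₁; inj₂)
open import Data.Empty using (⊥-elim)
open import Data.Vec using (Vec; lookup) renaming ([] to []ᵥ; _∷_ to _∷ᵥ_)
open import Relation.Nullary using (¬_; Dec; does; yes; no)
open import Relation.Nullary.Decidable using (dec-true; dec-false; does-⇔)
open import Function.Bundles using (mk⇔)
open import Relation.Binary.Bundles using (Preorder)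
open import Relation.Binary.Definitions using (tri<; tri≈; tri>)
open import Relation.Binary.PropositionalEquality as P using (_≡_; _≢_)
import Data.Fin.Properties as Fin
import Data.Bool.Properties as Bool
import Algebra.Properties.Group as GroupProperties
import Relation.Binary.Reasoning.Setoid as SetoidReasoning
import Relation.Binary.Reasoning.Preorder as PreorderReasoning

-- Write w = w' s with ℓ(w) = ℓ(w') + 1.  Then x ⋉ w = (s* ⊙ z') ⊙ s for
-- z' = x ⋉ w', the element w' is a minimal solution for z', and z ≠ z'; hence z is a twisted
-- ascent of z' along s: either s* z' s, of length ℓ(z') + 2, or z' s = s* z', of length ℓ(z') + 1.
-- Along the way x w is reduced and ℓ(w* z) + ℓ(w) ≤ ℓ(z).  Both statements then pass from w' to w
-- because u ↦ s ⊙ u, u ↦ u ⊙ s and u ↦ min(u, u s) are monotone for the Bruhat order, which is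
-- the lifting property.  The Coxeter-group input (parity of lengths and the exchange condition)
-- is derived from the presentation of W, through the sign character and Tits' reflection cocycle.

-- A decision procedure for equalities of group words, in which some atoms
-- may be declared involutions: words are normalised by free reduction,
-- an involution being its own inverse letter.
module GroupWords {c ℓ} (G : Group c ℓ) where
  open Group G
  open GroupProperties G
  open SetoidReasoning setoid

  data Atom : Set (c ⊔ ℓ) where
    plain      : Carrier → Atom
    involution : (a : Carrier) → a ∙ a ≈ ε → Atom

  value : Atom → Carrier
  value (plain a)        = a
  value (involution a _) = a

  infixl 7 _⊗_
  data Expr (n : ℕ) : Set where
    var : Fin n → Expr n
    one : Expr n
    _⊗_ : Expr n → Expr n → Expr n
    inv : Expr n → Expr n

  pattern X₀ = var zero
  pattern X₁ = var (suc zero)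
  pattern X₂ = var (suc (suc zero))
  pattern X₃ = var (suc (suc (suc zero)))

  -- (a , true) stands for the inverse of a; an involution is never inverted.
  power : Atom → Bool → Carrier
  power a false = value a
  power a true  = value a ⁻¹

  inverseFlag : Atom → Bool → Bool
  inverseFlag (plain _)        b = not b
  inverseFlag (involution _ _) _ = false

  power-inverse : ∀ a b → power a (inverseFlag a b) ≈ power a b ⁻¹
  power-inverse (plain a)            false = refl
  power-inverse (plain a)            true  = sym (⁻¹-involutive a)
  power-inverse (involution a a∙a≈ε) false = inverseʳ-unique a a a∙a≈ε
  power-inverse (involution a _)     true  = sym (⁻¹-involutive a)

  Letter : ℕ → Set
  Letter n = Fin n × Bool

  module _ {n : ℕ} (ρ : Vec Atom n) where
    ⟦_⟧ : Expr n → Carrier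
    ⟦ var i ⟧ = value (lookup ρ i)
    ⟦ one ⟧   = ε
    ⟦ a ⊗ b ⟧ = ⟦ a ⟧ ∙ ⟦ b ⟧
    ⟦ inv a ⟧ = ⟦ a ⟧ ⁻¹

    letter : Letter n → Carrier
    letter (i , b) = power (lookup ρ i) b

    inverseLetter : Letter n → Letter n
    inverseLetter (i , b) = i , inverseFlag (lookup ρ i) b

    letter-inverse : ∀ x → letter (inverseLetter x) ≈ letter x ⁻¹
    letter-inverse (i , b) = power-inverse (lookup ρ i) b

    evaluate : List (Letter n) → Carrier
    evaluate = foldr (λ x v → letter x ∙ v) ε

    reverseInverse : List (Letter n) → List (Letter n) → List (Letter n)
    reverseInverse acc []       = acc
    reverseInverse acc (x ∷ xs) = reverseInverse (inverseLetter x ∷ acc) xs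

    flatten : Expr n → List (Letter n)
    flatten (var i) = (i , false) ∷ []
    flatten one     = []
    flatten (a ⊗ b) = flatten a ++ flatten b
    flatten (inv a) = reverseInverse [] (flatten a)

    reducingCons : Letter n → List (Letter n) → List (Letter n)
    reducingCons x []       = x ∷ []
    reducingCons x (y ∷ ys) with ≡-dec Fin._≟_ Bool._≟_ y (inverseLetter x)
    ... | yes _ = ys
    ... | no _  = x ∷ y ∷ ys

    normalise : Expr n → List (Letter n)
    normalise e = foldr reducingCons [] (flatten e)

    evaluate-++ : ∀ xs ys → evaluate (xs ++ ys) ≈ evaluate xs ∙ evaluate ys
    evaluate-++ []       ys = sym (identityˡ _)
    evaluate-++ (x ∷ xs) ys = trans (∙-congˡ (evaluate-++ xs ys)) (sym (assoc _ _ _))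

    evaluate-reverseInverse : ∀ acc xs →
      evaluate (reverseInverse acc xs) ≈ evaluate xs ⁻¹ ∙ evaluate acc
    evaluate-reverseInverse acc [] = sym (trans (∙-congʳ ε⁻¹≈ε) (identityˡ _))
    evaluate-reverseInverse acc (x ∷ xs) = begin
      evaluate (reverseInverse (inverseLetter x ∷ acc) xs)
        ≈⟨ evaluate-reverseInverse (inverseLetter x ∷ acc) xs ⟩
      evaluate xs ⁻¹ ∙ (letter (inverseLetter x) ∙ evaluate acc)
        ≈⟨ ∙-congˡ (∙-congʳ (letter-inverse x)) ⟩
      evaluate xs ⁻¹ ∙ (letter x ⁻¹ ∙ evaluate acc)
        ≈⟨ sym (assoc _ _ _) ⟩
      evaluate xs ⁻¹ ∙ letter x ⁻¹ ∙ evaluate acc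
        ≈⟨ ∙-congʳ (sym (⁻¹-anti-homo-∙ _ _)) ⟩
      (letter x ∙ evaluate xs) ⁻¹ ∙ evaluate acc ∎

    evaluate-flatten : ∀ e → evaluate (flatten e) ≈ ⟦ e ⟧
    evaluate-flatten (var i) = identityʳ _
    evaluate-flatten one     = refl
    evaluate-flatten (a ⊗ b) =
      trans (evaluate-++ (flatten a) (flatten b)) (∙-cong (evaluate-flatten a) (evaluate-flatten b))
    evaluate-flatten (inv a) =
      trans (evaluate-reverseInverse [] (flatten a)) (trans (identityʳ _) (⁻¹-cong (evaluate-flatten a)))

    evaluate-reducingCons : ∀ x ys → evaluate (reducingCons x ys) ≈ letter x ∙ evaluate ys
    evaluate-reducingCons x []       = refl
    evaluate-reducingCons x (y ∷ ys) with ≡-dec Fin._≟_ Bool._≟_ y (inverseLetter x)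
    ... | no _       = refl
    ... | yes P.refl = sym (begin
      letter x ∙ (letter (inverseLetter x) ∙ evaluate ys) ≈⟨ ∙-congˡ (∙-congʳ (letter-inverse x)) ⟩
      letter x ∙ (letter x ⁻¹ ∙ evaluate ys)              ≈⟨ sym (assoc _ _ _) ⟩
      letter x ∙ letter x ⁻¹ ∙ evaluate ys                ≈⟨ ∙-congʳ (inverseʳ _) ⟩
      ε ∙ evaluate ys                                     ≈⟨ identityˡ _ ⟩
      evaluate ys                                         ∎)

    evaluate-normalise : ∀ e → evaluate (normalise e) ≈ ⟦ e ⟧
    evaluate-normalise e = trans (reduce (flatten e)) (evaluate-flatten e)
      where
      reduce : ∀ xs → evaluate (foldr reducingCons [] xs) ≈ evaluate xs
      reduce []       = refl
      reduce (x ∷ xs) = trans (evaluate-reducingCons x (foldr reducingCons [] xs)) (∙-congˡ (reduce xs))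

    solve : (e₁ e₂ : Expr n) → normalise e₁ ≡ normalise e₂ → ⟦ e₁ ⟧ ≈ ⟦ e₂ ⟧
    solve e₁ e₂ eq =
      trans (sym (evaluate-normalise e₁)) (trans (reflexive (P.cong evaluate eq)) (evaluate-normalise e₂))

ℤ₂ : Group 0ℓ 0ℓ
ℤ₂ = CommutativeRing.+-group xor-∧-commutativeRing

module _ (G : Group 0ℓ 0ℓ) where
  open Group G

  pow-identity : ∀ m → pow G ε m ≈ ε
  pow-identity zero    = refl
  pow-identity (suc m) = trans (identityˡ _) (pow-identity m)

  pow-+ : ∀ g m n → pow G g (m + n) ≈ pow G g m ∙ pow G g n
  pow-+ g zero    n = sym (identityˡ _)
  pow-+ g (suc m) n = trans (∙-congˡ (pow-+ g m n)) (sym (assoc _ _ _))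

  pow-comm : ∀ g m → pow G g m ∙ g ≈ g ∙ pow G g m
  pow-comm g zero    = trans (identityˡ g) (sym (identityʳ g))
  pow-comm g (suc m) = trans (assoc _ _ _) (∙-congˡ (pow-comm g m))

isOdd : ℕ → Bool
isOdd zero    = false
isOdd (suc n) = not (isOdd n)

module CoxeterGroup (T : TwistedCoxeterSystem) (ℓ : TCS.Carrier T → ℕ)
                     (isLength : TCS.IsLengthFunction T ℓ) where
  open TCS T
  open IsCoxeterSystem isCoxeter
  open IsLengthFunction isLength
  open GroupProperties W
  open GroupWords W
  module ⋆ = GroupMorphisms.IsGroupHomomorphism star-hom

  product-++ : ∀ (xs ys : Word W S) → prod W (xs ++ ys) ≈ prod W xs ∙ prod W ys
  product-++ []       ys = sym (identityˡ _)
  product-++ (x ∷ xs) ys = trans (∙-congˡ (product-++ xs ys)) (sym (assoc _ _ _))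

  ℓ-cong : ∀ {a b} → a ≈ b → ℓ a ≡ ℓ b
  ℓ-cong {a} {b} a≈b with ℓ-attained a | ℓ-attained b
  ... | as , as≈a , ∣as∣≡ℓa | bs , bs≈b , ∣bs∣≡ℓb = ≤-antisym
    (P.subst (ℓ a ≤_) ∣bs∣≡ℓb (ℓ-minimal a bs (trans bs≈b (sym a≈b))))
    (P.subst (ℓ b ≤_) ∣as∣≡ℓa (ℓ-minimal b as (trans as≈a a≈b)))

  ℓ-ε : ℓ ε ≡ 0
  ℓ-ε = n≤0⇒n≡0 (ℓ-minimal ε [] refl)

  ℓ≡0⇒≈ε : ∀ {a} → ℓ a ≡ 0 → a ≈ ε
  ℓ≡0⇒≈ε {a} ℓa≡0 with ℓ-attained a
  ... | []    , []≈a , _      = sym []≈a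
  ... | _ ∷ _ , _    , ∣as∣≡ℓa with P.trans ∣as∣≡ℓa ℓa≡0
  ...   | ()

  ℓ-∙ : ∀ a b → ℓ (a ∙ b) ≤ ℓ a + ℓ b
  ℓ-∙ a b with ℓ-attained a | ℓ-attained b
  ... | as , as≈a , ∣as∣≡ℓa | bs , bs≈b , ∣bs∣≡ℓb =
    P.subst (ℓ (a ∙ b) ≤_) (P.trans (length-++ as) (P.cong₂ _+_ ∣as∣≡ℓa ∣bs∣≡ℓb))
      (ℓ-minimal (a ∙ b) (as ++ bs) (trans (product-++ as bs) (∙-cong as≈a bs≈b)))

  ℓ-generator : ∀ {s} → S s → ℓ s ≡ 1
  ℓ-generator {s} s∈S with ℓ s in ℓs | ℓ-minimal s ((s , s∈S) ∷ []) (identityʳ s)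
  ... | zero        | _       = ⊥-elim (S-nontriv s∈S (ℓ≡0⇒≈ε ℓs))
  ... | suc zero    | _       = P.refl
  ... | suc (suc _) | s≤s ()

  ℓ-s∙ : ∀ {s} → S s → ∀ a → ℓ (s ∙ a) ≤ suc (ℓ a)
  ℓ-s∙ s∈S a = ≤-trans (ℓ-∙ _ a) (≤-reflexive (P.cong (_+ ℓ a) (ℓ-generator s∈S)))

  ℓ-∙s : ∀ {s} → S s → ∀ a → ℓ (a ∙ s) ≤ suc (ℓ a)
  ℓ-∙s s∈S a = ≤-trans (ℓ-∙ a _) (≤-reflexive (P.trans (P.cong (ℓ a +_) (ℓ-generator s∈S)) (+-comm (ℓ a) 1)))

  LeftFactor RightFactor : Carrier → ℕ → Set
  LeftFactor  a k = ∃[ s ] (S s × ∃[ a' ] (a ≈ s ∙ a' × ℓ a' ≡ k))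
  RightFactor a k = ∃[ s ] (S s × ∃[ a' ] (a ≈ a' ∙ s × ℓ a' ≡ k))

  leftFactor : ∀ {a k} → ℓ a ≡ suc k → LeftFactor a k
  leftFactor {a} {k} ℓa≡1+k with ℓ-attained a
  ... | [] , _ , ∣as∣≡ℓa with P.trans ∣as∣≡ℓa ℓa≡1+k
  ...   | ()
  leftFactor {a} {k} ℓa≡1+k | (s , s∈S) ∷ as , s∙as≈a , ∣as∣≡ℓa =
    s , s∈S , prod W as , sym s∙as≈a , ≤-antisym upper lower
    where
    upper : ℓ (prod W as) ≤ k
    upper = P.subst (ℓ (prod W as) ≤_) (suc-injective (P.trans ∣as∣≡ℓa ℓa≡1+k)) (ℓ-minimal _ as refl)
    lower : k ≤ ℓ (prod W as)
    lower = s≤s⁻¹ (P.subst (_≤ suc (ℓ (prod W as))) ℓa≡1+k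
              (≤-trans (≤-reflexive (ℓ-cong (sym s∙as≈a))) (ℓ-s∙ s∈S (prod W as))))

  -- the word metric makes equality decidable: a ≈ b iff ℓ (a ⁻¹ ∙ b) ≡ 0
  infix 4 _≈?_
  _≈?_ : ∀ a b → Dec (a ≈ b)
  a ≈? b with ℓ (a ⁻¹ ∙ b) ≟ 0
  ... | yes ℓ≡0 = yes (sym (begin
        b               ≈⟨ solve (plain a ∷ᵥ plain b ∷ᵥ []ᵥ) X₁ (X₀ ⊗ (inv X₀ ⊗ X₁)) P.refl ⟩
        a ∙ (a ⁻¹ ∙ b)  ≈⟨ ∙-congˡ (ℓ≡0⇒≈ε ℓ≡0) ⟩
        a ∙ ε           ≈⟨ identityʳ a ⟩
        a               ∎))
    where open SetoidReasoning setoid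
  ... | no ℓ≢0 = no λ a≈b → ℓ≢0 (P.trans (ℓ-cong (trans (∙-congˡ (sym a≈b)) (inverseˡ a))) ℓ-ε)

  involution-ℓ : (f : Carrier → Carrier) → (∀ a → f (f a) ≈ a) → (∀ a → ℓ (f a) ≤ ℓ a) → ∀ a → ℓ (f a) ≡ ℓ a
  involution-ℓ f f∘f≈id ℓ-f≤ a = ≤-antisym (ℓ-f≤ a) (P.subst (_≤ ℓ (f a)) (ℓ-cong (f∘f≈id a)) (ℓ-f≤ (f a)))

  ℓ-⁻¹ : ∀ a → ℓ (a ⁻¹) ≡ ℓ a
  ℓ-⁻¹ = involution-ℓ _⁻¹ ⁻¹-involutive (λ a → bound (ℓ a) a P.refl)
    where
    bound : ∀ k a → ℓ a ≡ k → ℓ (a ⁻¹) ≤ k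
    bound zero    a ℓa≡0 = ≤-reflexive (P.trans (ℓ-cong (trans (⁻¹-cong (ℓ≡0⇒≈ε ℓa≡0)) ε⁻¹≈ε)) ℓ-ε)
    bound (suc k) a ℓa≡1+k with leftFactor ℓa≡1+k
    ... | s , s∈S , a' , a≈s∙a' , ℓa'≡k = begin
      ℓ (a ⁻¹)         ≡⟨ ℓ-cong (trans (⁻¹-cong a≈s∙a') (solve (plain a' ∷ᵥ involution s (S-invol s∈S) ∷ᵥ []ᵥ)
                                                        (inv (X₁ ⊗ X₀)) (inv X₀ ⊗ X₁) P.refl)) ⟩
      ℓ (a' ⁻¹ ∙ s)    ≤⟨ ℓ-∙s s∈S (a' ⁻¹) ⟩
      suc (ℓ (a' ⁻¹))  ≤⟨ s≤s (bound k a' ℓa'≡k) ⟩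
      suc k            ∎
      where open ≤-Reasoning

  ℓ-star : ∀ a → ℓ (star a) ≡ ℓ a
  ℓ-star = involution-ℓ star star-invol (λ a → bound (ℓ a) a P.refl)
    where
    bound : ∀ k a → ℓ a ≡ k → ℓ (star a) ≤ k
    bound zero    a ℓa≡0 = ≤-reflexive (P.trans (ℓ-cong (trans (⋆.⟦⟧-cong (ℓ≡0⇒≈ε ℓa≡0)) ⋆.ε-homo)) ℓ-ε)
    bound (suc k) a ℓa≡1+k with leftFactor ℓa≡1+k
    ... | s , s∈S , a' , a≈s∙a' , ℓa'≡k = begin
      ℓ (star a)            ≡⟨ ℓ-cong (trans (⋆.⟦⟧-cong a≈s∙a') (⋆.homo s a')) ⟩
      ℓ (star s ∙ star a')  ≤⟨ ℓ-s∙ (star-S s∈S) (star a') ⟩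
      suc (ℓ (star a'))     ≤⟨ s≤s (bound k a' ℓa'≡k) ⟩
      suc k                 ∎
      where open ≤-Reasoning

  rightFactor : ∀ {a k} → ℓ a ≡ suc k → RightFactor a k
  rightFactor {a} {k} ℓa≡1+k with leftFactor {a ⁻¹} {k} (P.trans (ℓ-⁻¹ a) ℓa≡1+k)
  ... | s , s∈S , b , a⁻¹≈s∙b , ℓb≡k = s , s∈S , b ⁻¹ ,
        trans (sym (⁻¹-involutive a)) (trans (⁻¹-cong a⁻¹≈s∙b)
          (solve (plain b ∷ᵥ involution s (S-invol s∈S) ∷ᵥ []ᵥ) (inv (X₁ ⊗ X₀)) (inv X₀ ⊗ X₁) P.refl)) ,
        P.trans (ℓ-⁻¹ b) ℓb≡k

  signCharacter : ∃[ σ ] (GroupMorphisms.IsGroupHomomorphism (Group.rawGroup W) (Group.rawGroup ℤ₂) σ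
                         × (∀ {s} → S s → σ s ≡ true))
  signCharacter = universal ℤ₂ (λ _ → true) (λ _ _ _ → P.refl) (λ _ _ m _ → pow-identity ℤ₂ m)

  sign : Carrier → Bool
  sign = proj₁ signCharacter

  module Sign = GroupMorphisms.IsGroupHomomorphism (proj₁ (proj₂ signCharacter))

  sign-generator : ∀ {s} → S s → sign s ≡ true
  sign-generator = proj₂ (proj₂ signCharacter)

  sign≡isOdd∘ℓ : ∀ a → sign a ≡ isOdd (ℓ a)
  sign≡isOdd∘ℓ a = go (ℓ a) a P.refl
    where
    go : ∀ k a → ℓ a ≡ k → sign a ≡ isOdd k
    go zero    a ℓa≡0 = P.trans (Sign.⟦⟧-cong (ℓ≡0⇒≈ε ℓa≡0)) Sign.ε-homo
    go (suc k) a ℓa≡1+k with leftFactor ℓa≡1+k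
    ... | s , s∈S , a' , a≈s∙a' , ℓa'≡k = P.trans (Sign.⟦⟧-cong a≈s∙a')
      (P.trans (Sign.homo s a') (P.cong₂ _xor_ (sign-generator s∈S) (go k a' ℓa'≡k)))

  sign-flip⇒ℓ≢ : ∀ {a b} → sign b ≡ not (sign a) → ℓ a ≢ ℓ b
  sign-flip⇒ℓ≢ {a} {b} sb≡¬sa ℓa≡ℓb = not-¬ P.refl
    (P.trans (P.sym (P.trans (sign≡isOdd∘ℓ b) (P.cong isOdd (P.sym ℓa≡ℓb))))
      (P.trans sb≡¬sa (P.cong not (sign≡isOdd∘ℓ a))))

  adjacent-lengths : ∀ a b → ℓ b ≤ suc (ℓ a) → ℓ a ≤ suc (ℓ b) → sign b ≡ not (sign a) →
                     suc (ℓ a) ≡ ℓ b ⊎ suc (ℓ b) ≡ ℓ a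
  adjacent-lengths a b ℓb≤ ℓa≤ sb≡¬sa with <-cmp (ℓ a) (ℓ b)
  ... | tri< ℓa<ℓb _ _ = inj₁ (≤-antisym ℓa<ℓb ℓb≤)
  ... | tri≈ _ ℓa≡ℓb _ = ⊥-elim (sign-flip⇒ℓ≢ sb≡¬sa ℓa≡ℓb)
  ... | tri> _ _ ℓb<ℓa = inj₂ (≤-antisym ℓb<ℓa ℓa≤)

  ℓ-s∙-cases : ∀ {s} → S s → ∀ a → suc (ℓ a) ≡ ℓ (s ∙ a) ⊎ suc (ℓ (s ∙ a)) ≡ ℓ a
  ℓ-s∙-cases {s} s∈S a = adjacent-lengths a (s ∙ a) (ℓ-s∙ s∈S a)
    (P.subst (_≤ suc (ℓ (s ∙ a)))
      (ℓ-cong (solve (plain a ∷ᵥ involution s (S-invol s∈S) ∷ᵥ []ᵥ) (X₁ ⊗ (X₁ ⊗ X₀)) X₀ P.refl))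
      (ℓ-s∙ s∈S (s ∙ a)))
    (P.trans (Sign.homo s a) (P.cong (_xor sign a) (sign-generator s∈S)))

  ℓ-∙s-cases : ∀ {s} → S s → ∀ a → suc (ℓ a) ≡ ℓ (a ∙ s) ⊎ suc (ℓ (a ∙ s)) ≡ ℓ a
  ℓ-∙s-cases {s} s∈S a = adjacent-lengths a (a ∙ s) (ℓ-∙s s∈S a)
    (P.subst (_≤ suc (ℓ (a ∙ s)))
      (ℓ-cong (solve (plain a ∷ᵥ involution s (S-invol s∈S) ∷ᵥ []ᵥ) (X₀ ⊗ X₁ ⊗ X₁) X₀ P.refl))
      (ℓ-∙s s∈S (a ∙ s)))
    (P.trans (Sign.homo a s) (P.trans (P.cong (sign a xor_) (sign-generator s∈S)) (xor-comm (sign a) true)))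

  conj : Carrier → Carrier → Carrier
  conj g a = g ∙ a ∙ g ⁻¹

  conj-cong : ∀ {g g' a a'} → g ≈ g' → a ≈ a' → conj g a ≈ conj g' a'
  conj-cong g≈g' a≈a' = ∙-cong (∙-cong g≈g' a≈a') (⁻¹-cong g≈g')

  conj-∙ : ∀ g h a → conj g (conj h a) ≈ conj (g ∙ h) a
  conj-∙ g h a = solve (plain g ∷ᵥ plain h ∷ᵥ plain a ∷ᵥ []ᵥ)
    (X₀ ⊗ (X₁ ⊗ X₂ ⊗ inv X₁) ⊗ inv X₀) (X₀ ⊗ X₁ ⊗ X₂ ⊗ inv (X₀ ⊗ X₁)) P.refl

  generator⇒reflection : ∀ {s} → S s → Reflection s
  generator⇒reflection {s} s∈S = ε , s , s∈S , solve (plain s ∷ᵥ []ᵥ) X₀ (one ⊗ X₀ ⊗ inv one) P.refl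

  reflection-conj : ∀ {t} → Reflection t → ∀ h → Reflection (conj h t)
  reflection-conj (g , s , s∈S , t≈gsg⁻¹) h =
    h ∙ g , s , s∈S , trans (conj-cong refl t≈gsg⁻¹) (conj-∙ h g s)

  reflection-involution : ∀ {t} → Reflection t → t ∙ t ≈ ε
  reflection-involution (g , s , s∈S , t≈gsg⁻¹) = trans (∙-cong t≈gsg⁻¹ t≈gsg⁻¹)
    (solve (plain g ∷ᵥ involution s (S-invol s∈S) ∷ᵥ []ᵥ) (X₀ ⊗ X₁ ⊗ inv X₀ ⊗ (X₀ ⊗ X₁ ⊗ inv X₀)) one P.refl)

  sign-reflection : ∀ {t} → Reflection t → sign t ≡ true
  sign-reflection {t} (g , s , s∈S , t≈gsg⁻¹) = begin
    sign t                              ≡⟨ Sign.⟦⟧-cong t≈gsg⁻¹ ⟩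
    sign (g ∙ s ∙ g ⁻¹)                 ≡⟨ Sign.homo (g ∙ s) (g ⁻¹) ⟩
    sign (g ∙ s) xor sign (g ⁻¹)        ≡⟨ P.cong₂ _xor_ (Sign.homo g s) (Sign.⁻¹-homo g) ⟩
    (sign g xor sign s) xor sign g      ≡⟨ P.cong (λ b → (sign g xor b) xor sign g) (sign-generator s∈S) ⟩
    (sign g xor true) xor sign g        ≡⟨ cancel (sign g) ⟩
    true                                ∎
    where
    open P.≡-Reasoning
    cancel : ∀ b → (b xor true) xor b ≡ true
    cancel false = P.refl
    cancel true  = P.refl

  ℓ-∙reflection≢ : ∀ {t} → Reflection t → ∀ a → ℓ (a ∙ t) ≢ ℓ a
  ℓ-∙reflection≢ {t} t∈T a ℓat≡ℓa = sign-flip⇒ℓ≢ {a} {a ∙ t}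
    (P.trans (Sign.homo a t) (P.trans (P.cong (sign a xor_) (sign-reflection t∈T)) (xor-comm (sign a) true)))
    (P.sym ℓat≡ℓa)

  generator-cancelˡ : ∀ {s} → S s → ∀ a → s ∙ (s ∙ a) ≈ a
  generator-cancelˡ {s} s∈S a = solve (involution s (S-invol s∈S) ∷ᵥ plain a ∷ᵥ []ᵥ) (X₀ ⊗ (X₀ ⊗ X₁)) X₁ P.refl

  generator-cancelʳ : ∀ {s} → S s → ∀ a → a ∙ s ∙ s ≈ a
  generator-cancelʳ {s} s∈S a = solve (involution s (S-invol s∈S) ∷ᵥ plain a ∷ᵥ []ᵥ) (X₁ ⊗ X₀ ⊗ X₀) X₁ P.refl

xorSum : (ℕ → Bool) → ℕ → Bool
xorSum g zero    = false
xorSum g (suc n) = xorSum g n xor g n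

xorSum-cong : ∀ {g h} → (∀ i → g i ≡ h i) → ∀ n → xorSum g n ≡ xorSum h n
xorSum-cong g≗h zero    = P.refl
xorSum-cong g≗h (suc n) = P.cong₂ _xor_ (xorSum-cong g≗h n) (g≗h n)

xorSum-+ : ∀ g m n → xorSum g (m + n) ≡ xorSum g m xor xorSum (λ i → g (m + i)) n
xorSum-+ g m zero    = P.trans (P.cong (xorSum g) (+-identityʳ m)) (P.sym (xor-identityʳ _))
xorSum-+ g m (suc n) = P.trans (P.cong (xorSum g) (+-suc m n))
  (P.trans (P.cong (_xor g (m + n)) (xorSum-+ g m n)) (xor-assoc (xorSum g m) _ _))

xorSum-periodic : ∀ g m → (∀ i → g (m + i) ≡ g i) → xorSum g (m + m) ≡ false
xorSum-periodic g m periodic =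
  P.trans (xorSum-+ g m m) (P.trans (P.cong (xorSum g m xor_) (xorSum-cong periodic m)) (xor-same (xorSum g m)))

module ReflectionCocycle (T : TwistedCoxeterSystem) (ℓ : TCS.Carrier T → ℕ)
                         (isLength : TCS.IsLengthFunction T ℓ) where
  open TCS T
  open IsCoxeterSystem isCoxeter
  open IsLengthFunction isLength
  open GroupProperties W
  open GroupWords W
  open CoxeterGroup T ℓ isLength

  δ : Carrier → Carrier → Bool
  δ a b = does (a ≈? b)

  δ-cong : ∀ {a b c d} → (a ≈ b → c ≈ d) → (c ≈ d → a ≈ b) → δ a b ≡ δ c d
  δ-cong {a} {b} {c} {d} to from = does-⇔ (mk⇔ to from) (a ≈? b) (c ≈? d)

  -- The semidirect product of W with the Bool-valued functions on W, W acting by conjugation.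
  -- Sending each generator s to (s , [· ≈ s]) extends to the homomorphism
  -- w ↦ (w , t ↦ [t is a right inversion of w]): Tits' reflection cocycle.
  record Marked : Set where
    constructor marked
    field
      element   : Carrier
      mark      : Carrier → Bool
      mark-cong : ∀ {a b} → a ≈ b → mark a ≡ mark b
  open Marked

  _≈ᴹ_ : Marked → Marked → Set
  p ≈ᴹ q = element p ≈ element q × (∀ a → mark p a ≡ mark q a)

  _∙ᴹ_ : Marked → Marked → Marked
  p ∙ᴹ q = marked (element p ∙ element q) (λ a → mark q a xor mark p (conj (element q) a))
    (λ a≈b → P.cong₂ _xor_ (mark-cong q a≈b) (mark-cong p (conj-cong refl a≈b)))

  εᴹ : Marked
  εᴹ = marked ε (λ _ → false) (λ _ → P.refl)

  _⁻¹ᴹ : Marked → Marked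
  p ⁻¹ᴹ = marked (element p ⁻¹) (λ a → mark p (conj (element p ⁻¹) a)) (λ a≈b → mark-cong p (conj-cong refl a≈b))

  MarkedGroup : Group 0ℓ 0ℓ
  MarkedGroup = record
    { Carrier = Marked ; _≈_ = _≈ᴹ_ ; _∙_ = _∙ᴹ_ ; ε = εᴹ ; _⁻¹ = _⁻¹ᴹ
    ; isGroup = record
      { isMonoid = record
        { isSemigroup = record
          { isMagma = record
            { isEquivalence = record
              { refl  = refl , λ _ → P.refl
              ; sym   = λ (e , m) → sym e , λ a → P.sym (m a)
              ; trans = λ (e , m) (e' , m') → trans e e' , λ a → P.trans (m a) (m' a) }
            ; ∙-cong = λ {p} {p'} (e , m) (e' , m') → ∙-cong e e' ,
                λ a → P.cong₂ _xor_ (m' a) (P.trans (m _) (mark-cong p' (conj-cong e' refl))) }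
          ; assoc = λ p q r → assoc _ _ _ , λ a →
              P.trans (P.sym (xor-assoc (mark r a) _ _))
                (P.cong ((mark r a xor mark q (conj (element r) a)) xor_)
                  (mark-cong p (conj-∙ (element q) (element r) a))) }
        ; identity = (λ p → identityˡ _ , λ a → xor-identityʳ (mark p a))
                   , (λ p → identityʳ _ , λ a → mark-cong p
                        (solve (plain a ∷ᵥ []ᵥ) (one ⊗ X₀ ⊗ inv one) X₀ P.refl)) }
      ; inverse = (λ p → inverseˡ _ , λ a → P.trans
                      (P.cong (mark p a xor_) (mark-cong p (solve (plain (element p) ∷ᵥ plain a ∷ᵥ []ᵥ)
                        (inv X₀ ⊗ (X₀ ⊗ X₁ ⊗ inv X₀) ⊗ inv (inv X₀)) X₁ P.refl)))
                      (xor-same (mark p a)))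
                , (λ p → inverseʳ _ , λ a → xor-same (mark p (conj (element p ⁻¹) a)))
      ; ⁻¹-cong = λ {p} {q} (e , m) → ⁻¹-cong e , λ a → P.trans (m _) (mark-cong q (conj-cong (⁻¹-cong e) refl)) } }

  generatorᴹ : Carrier → Marked
  generatorᴹ s = marked s (λ a → δ a s) (λ a≈b → δ-cong (trans (sym a≈b)) (trans a≈b))

  element-pow : ∀ p m → element (pow MarkedGroup p m) ≡ pow W (element p) m
  element-pow p zero    = P.refl
  element-pow p (suc m) = P.cong (element p ∙_) (element-pow p m)

  conj≈⇒≈conj⁻¹ : ∀ {g a b} → conj g a ≈ b → a ≈ g ⁻¹ ∙ b ∙ g
  conj≈⇒≈conj⁻¹ {g} {a} {b} ga≈b =
    trans (solve (plain g ∷ᵥ plain a ∷ᵥ []ᵥ) X₁ (inv X₀ ⊗ (X₀ ⊗ X₁ ⊗ inv X₀) ⊗ X₀) P.refl) (∙-congʳ (∙-congˡ ga≈b))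

  ≈conj⁻¹⇒conj≈ : ∀ {g a b} → a ≈ g ⁻¹ ∙ b ∙ g → conj g a ≈ b
  ≈conj⁻¹⇒conj≈ {g} {a} {b} a≈ = trans (conj-cong refl a≈)
    (solve (plain g ∷ᵥ plain b ∷ᵥ []ᵥ) (X₀ ⊗ (inv X₀ ⊗ X₁ ⊗ X₀) ⊗ inv X₀) X₁ P.refl)

  -- The mark at a of the m-th power of (generatorᴹ s ∙ᴹ generatorᴹ t) counts the occurrences
  -- of a in t, ts t, (ts)² t, …, (ts)^(2m-1) t, a list which is m-periodic once (st)^m = 1.
  module CoxeterRelation {s t : Carrier} (s∈S : S s) (t∈S : S t) where
    st ts : Carrier
    st = s ∙ t
    ts = t ∙ s

    s' t' : Atom
    s' = involution s (S-invol s∈S)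
    t' = involution t (S-invol t∈S)

    st^m⁻¹≈ts^m : ∀ m → pow W st m ⁻¹ ≈ pow W ts m
    st^m⁻¹≈ts^m zero    = ε⁻¹≈ε
    st^m⁻¹≈ts^m (suc m) = trans (⁻¹-anti-homo-∙ st (pow W st m))
      (trans (∙-cong (st^m⁻¹≈ts^m m) (solve (s' ∷ᵥ t' ∷ᵥ []ᵥ) (inv (X₀ ⊗ X₁)) (X₁ ⊗ X₀) P.refl)) (pow-comm W ts m))

    t∙st^m : ∀ m → t ∙ pow W st m ≈ pow W ts m ∙ t
    t∙st^m zero    = trans (identityʳ t) (sym (identityˡ t))
    t∙st^m (suc m) = begin
      t ∙ (st ∙ pow W st m)   ≈⟨ solve (t' ∷ᵥ s' ∷ᵥ plain (pow W st m) ∷ᵥ []ᵥ)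
                                  (X₀ ⊗ (X₁ ⊗ X₀ ⊗ X₂)) (X₀ ⊗ X₁ ⊗ (X₀ ⊗ X₂)) P.refl ⟩
      ts ∙ (t ∙ pow W st m)   ≈⟨ ∙-congˡ (t∙st^m m) ⟩
      ts ∙ (pow W ts m ∙ t)   ≈⟨ sym (assoc _ _ _) ⟩
      ts ∙ pow W ts m ∙ t     ∎
      where open SetoidReasoning setoid

    markedST : Marked
    markedST = generatorᴹ s ∙ᴹ generatorᴹ t

    module _ (a : Carrier) where
      hits : ℕ → Bool
      hits i = δ a (pow W ts i ∙ t)

      even-hit : ∀ m → pow W st m ⁻¹ ∙ t ∙ pow W st m ≈ pow W ts (m + m) ∙ t
      even-hit m = begin
        pow W st m ⁻¹ ∙ t ∙ pow W st m    ≈⟨ assoc _ _ _ ⟩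
        pow W st m ⁻¹ ∙ (t ∙ pow W st m)  ≈⟨ ∙-cong (st^m⁻¹≈ts^m m) (t∙st^m m) ⟩
        pow W ts m ∙ (pow W ts m ∙ t)     ≈⟨ sym (assoc _ _ _) ⟩
        pow W ts m ∙ pow W ts m ∙ t       ≈⟨ ∙-congʳ (sym (pow-+ W ts m m)) ⟩
        pow W ts (m + m) ∙ t              ∎
        where open SetoidReasoning setoid

      odd-hit : ∀ m → (t ∙ pow W st m) ⁻¹ ∙ s ∙ (t ∙ pow W st m) ≈ pow W ts (suc (m + m)) ∙ t
      odd-hit m = begin
        (t ∙ pow W st m) ⁻¹ ∙ s ∙ (t ∙ pow W st m)  ≈⟨ solve (t' ∷ᵥ s' ∷ᵥ plain (pow W st m) ∷ᵥ []ᵥ)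
                                                        (inv (X₀ ⊗ X₂) ⊗ X₁ ⊗ (X₀ ⊗ X₂))
                                                        (inv X₂ ⊗ (X₀ ⊗ X₁) ⊗ (X₀ ⊗ X₂)) P.refl ⟩
        pow W st m ⁻¹ ∙ ts ∙ (t ∙ pow W st m)       ≈⟨ ∙-cong (∙-congʳ (st^m⁻¹≈ts^m m)) (t∙st^m m) ⟩
        pow W ts m ∙ ts ∙ (pow W ts m ∙ t)          ≈⟨ ∙-congʳ (pow-comm W ts m) ⟩
        ts ∙ pow W ts m ∙ (pow W ts m ∙ t)          ≈⟨ solve (plain ts ∷ᵥ plain (pow W ts m) ∷ᵥ plain t ∷ᵥ []ᵥ)
                                                        (X₀ ⊗ X₁ ⊗ (X₁ ⊗ X₂)) (X₀ ⊗ X₁ ⊗ X₁ ⊗ X₂) P.refl ⟩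
        ts ∙ pow W ts m ∙ pow W ts m ∙ t            ≈⟨ ∙-congʳ (sym (pow-+ W ts (suc m) m)) ⟩
        pow W ts (suc (m + m)) ∙ t                  ∎
        where open SetoidReasoning setoid

      mark-markedST : ∀ m → mark markedST (conj (pow W st m) a) ≡ hits (m + m) xor hits (suc (m + m))
      mark-markedST m = P.cong₂ _xor_
        (δ-cong (λ e → trans (conj≈⇒≈conj⁻¹ e) (even-hit m)) (λ e → ≈conj⁻¹⇒conj≈ (trans e (sym (even-hit m)))))
        (δ-cong (λ e → trans (conj≈⇒≈conj⁻¹ (trans (sym conj-t) e)) (odd-hit m))
                (λ e → trans conj-t (≈conj⁻¹⇒conj≈ (trans e (sym (odd-hit m))))))
        where
        conj-t : conj t (conj (pow W st m) a) ≈ conj (t ∙ pow W st m) a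
        conj-t = conj-∙ t (pow W st m) a

      mark-markedST^m : ∀ m → mark (pow MarkedGroup markedST m) a ≡ xorSum hits (m + m)
      mark-markedST^m zero    = P.refl
      mark-markedST^m (suc m) = P.trans
        (P.cong₂ _xor_ (mark-markedST^m m)
          (P.trans (P.cong (λ g → mark markedST (conj g a)) (element-pow markedST m)) (mark-markedST m)))
        (P.trans (P.sym (xor-assoc (xorSum hits (m + m)) _ _))
          (P.cong (λ k → xorSum hits (suc k)) (P.sym (+-suc m m))))

      hits-periodic : ∀ m → pow W st m ≈ ε → ∀ i → hits (m + i) ≡ hits i
      hits-periodic m st^m≈ε i = δ-cong (λ e → trans e (∙-congʳ shift)) (λ e → trans e (∙-congʳ (sym shift)))
        where
        ts^m≈ε : pow W ts m ≈ ε
        ts^m≈ε = trans (sym (st^m⁻¹≈ts^m m)) (trans (⁻¹-cong st^m≈ε) ε⁻¹≈ε)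
        shift : pow W ts (m + i) ≈ pow W ts i
        shift = trans (pow-+ W ts m i) (trans (∙-congʳ ts^m≈ε) (identityˡ _))

    relation : ∀ m → pow W st m ≈ ε → pow MarkedGroup markedST m ≈ᴹ εᴹ
    relation m st^m≈ε = trans (reflexive (element-pow markedST m)) st^m≈ε ,
      λ a → P.trans (mark-markedST^m a m) (xorSum-periodic (hits a) m (hits-periodic a m st^m≈ε))

  reflectionCocycle : ∃[ φ ] (GroupMorphisms.IsGroupHomomorphism (Group.rawGroup W) (Group.rawGroup MarkedGroup) φ
                            × (∀ {s} → S s → φ s ≈ᴹ generatorᴹ s))
  reflectionCocycle = universal MarkedGroup (λ s → generatorᴹ (proj₁ s))
    (λ _ _ s≈t → s≈t , λ a → δ-cong (λ a≈s → trans a≈s s≈t) (λ a≈t → trans a≈t (sym s≈t)))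
    (λ s∈S t∈S m → CoxeterRelation.relation s∈S t∈S m)

  φ : Carrier → Marked
  φ = proj₁ reflectionCocycle

  module Φ = GroupMorphisms.IsGroupHomomorphism (proj₁ (proj₂ reflectionCocycle))

  inverts : Carrier → Carrier → Bool
  inverts w = mark (φ w)

  element-φ : ∀ a → element (φ a) ≈ a
  element-φ a with generated a
  ... | ws , ws≈a = trans (proj₁ (Φ.⟦⟧-cong (sym ws≈a))) (trans (on-words ws) ws≈a)
    where
    on-words : ∀ (ws : Word W S) → element (φ (prod W ws)) ≈ prod W ws
    on-words []               = proj₁ Φ.ε-homo
    on-words ((s , s∈S) ∷ ws) =
      trans (proj₁ (Φ.homo s (prod W ws))) (∙-cong (proj₁ (proj₂ (proj₂ reflectionCocycle) s∈S)) (on-words ws))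

  inverts-cong : ∀ {a a' b b'} → a ≈ a' → b ≈ b' → inverts a b ≡ inverts a' b'
  inverts-cong {a' = a'} a≈a' b≈b' = P.trans (proj₂ (Φ.⟦⟧-cong a≈a') _) (mark-cong (φ a') b≈b')

  inverts-∙ : ∀ a b g → inverts (a ∙ b) g ≡ inverts b g xor inverts a (conj b g)
  inverts-∙ a b g = P.trans (proj₂ (Φ.homo a b) g)
    (P.cong (inverts b g xor_) (inverts-cong refl (conj-cong (element-φ b) refl)))

  inverts-ε : ∀ g → inverts ε g ≡ false
  inverts-ε = proj₂ Φ.ε-homo

  inverts-generator : ∀ {s} → S s → ∀ g → inverts s g ≡ δ g s
  inverts-generator s∈S = proj₂ (proj₂ (proj₂ reflectionCocycle) s∈S)

  inverts-s∙ : ∀ {s} → S s → ∀ a g → inverts (s ∙ a) g ≡ inverts a g xor δ (conj a g) s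
  inverts-s∙ s∈S a g = P.trans (inverts-∙ _ a g) (P.cong (inverts a g xor_) (inverts-generator s∈S _))

  inverts⇒shorter : ∀ {w t} → inverts w t ≡ true → ℓ (w ∙ t) < ℓ w
  inverts⇒shorter {w} {t} = go (ℓ w) w P.refl
    where
    go : ∀ k w → ℓ w ≡ k → inverts w t ≡ true → ℓ (w ∙ t) < ℓ w
    go zero w ℓw≡0 w-inverts = ⊥-elim (not-¬ P.refl
      (P.trans (P.sym w-inverts) (P.trans (inverts-cong (ℓ≡0⇒≈ε ℓw≡0) refl) (inverts-ε t))))
    go (suc k) w ℓw≡1+k w-inverts with leftFactor ℓw≡1+k
    ... | s , s∈S , w' , w≈s∙w' , ℓw'≡k with conj w' t ≈? s
    ...   | yes w'tw'⁻¹≈s = ≤-reflexive (P.trans (P.cong suc (P.trans (ℓ-cong wt≈w') ℓw'≡k)) (P.sym ℓw≡1+k))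
      where
      wt≈w' : w ∙ t ≈ w'
      wt≈w' = begin
        w ∙ t                ≈⟨ ∙-congʳ w≈s∙w' ⟩
        s ∙ w' ∙ t           ≈⟨ solve (plain s ∷ᵥ plain w' ∷ᵥ plain t ∷ᵥ []ᵥ)
                                  (X₀ ⊗ X₁ ⊗ X₂) (X₀ ⊗ (X₁ ⊗ X₂ ⊗ inv X₁) ⊗ X₁) P.refl ⟩
        s ∙ conj w' t ∙ w'   ≈⟨ ∙-congʳ (∙-congˡ w'tw'⁻¹≈s) ⟩
        s ∙ s ∙ w'           ≈⟨ solve (involution s (S-invol s∈S) ∷ᵥ plain w' ∷ᵥ []ᵥ) (X₀ ⊗ X₀ ⊗ X₁) X₁ P.refl ⟩
        w'                   ∎
        where open SetoidReasoning setoid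
    ...   | no w'tw'⁻¹≉s = ≤-trans (s≤s (begin
        ℓ (w ∙ t)         ≡⟨ ℓ-cong (trans (∙-congʳ w≈s∙w') (assoc _ _ _)) ⟩
        ℓ (s ∙ (w' ∙ t))  ≤⟨ ℓ-s∙ s∈S (w' ∙ t) ⟩
        suc (ℓ (w' ∙ t))  ≤⟨ go k w' ℓw'≡k w'-inverts ⟩
        ℓ w'              ≡⟨ ℓw'≡k ⟩
        k                 ∎)) (≤-reflexive (P.sym ℓw≡1+k))
      where
      open ≤-Reasoning
      w'-inverts : inverts w' t ≡ true
      w'-inverts = P.trans (P.sym (xor-identityʳ _)) (P.trans (P.cong (inverts w' t xor_) (P.sym (dec-false (conj w' t ≈? s) w'tw'⁻¹≉s)))
        (P.trans (P.sym (inverts-s∙ s∈S w' t)) (P.trans (P.sym (inverts-cong w≈s∙w' refl)) w-inverts)))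

  inverts-self : ∀ {t} → Reflection t → inverts t t ≡ true
  inverts-self {t} (g , r , r∈S , t≈grg⁻¹) = begin
    inverts t t                                   ≡⟨ inverts-cong t≈grg⁻¹ refl ⟩
    inverts (g ∙ r ∙ g ⁻¹) t                      ≡⟨ inverts-∙ (g ∙ r) (g ⁻¹) t ⟩
    inverts (g ⁻¹) t xor inverts (g ∙ r) (conj (g ⁻¹) t)
      ≡⟨ P.cong (inverts (g ⁻¹) t xor_) (P.trans (inverts-cong refl g⁻¹tg≈r) (inverts-∙ g r r)) ⟩
    inverts (g ⁻¹) t xor (inverts r r xor inverts g (conj r r))
      ≡⟨ P.cong (λ b → inverts (g ⁻¹) t xor (b xor inverts g (conj r r)))
           (P.trans (inverts-generator r∈S r) (dec-true (r ≈? r) refl)) ⟩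
    inverts (g ⁻¹) t xor (true xor inverts g (conj r r))
      ≡⟨ P.cong (λ b → inverts (g ⁻¹) t xor (true xor b)) (inverts-cong refl rrr≈r) ⟩
    inverts (g ⁻¹) t xor (true xor inverts g r)
      ≡⟨ rearrange (inverts (g ⁻¹) t) (inverts g r) ⟩
    true xor (inverts (g ⁻¹) t xor inverts g r)
      ≡⟨ P.cong (true xor_) cocycle-gg⁻¹ ⟩
    true                                          ∎
    where
    open P.≡-Reasoning
    g⁻¹tg≈r : conj (g ⁻¹) t ≈ r
    g⁻¹tg≈r = trans (conj-cong refl t≈grg⁻¹)
      (solve (plain g ∷ᵥ plain r ∷ᵥ []ᵥ) (inv X₀ ⊗ (X₀ ⊗ X₁ ⊗ inv X₀) ⊗ inv (inv X₀)) X₁ P.refl)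
    rrr≈r : conj r r ≈ r
    rrr≈r = solve (involution r (S-invol r∈S) ∷ᵥ []ᵥ) (X₀ ⊗ X₀ ⊗ inv X₀) X₀ P.refl
    cocycle-gg⁻¹ : inverts (g ⁻¹) t xor inverts g r ≡ false
    cocycle-gg⁻¹ = P.trans (P.cong (inverts (g ⁻¹) t xor_) (P.sym (inverts-cong refl g⁻¹tg≈r)))
      (P.trans (P.sym (inverts-∙ g (g ⁻¹) t)) (P.trans (inverts-cong (inverseʳ g) refl) (inverts-ε t)))
    rearrange : ∀ x y → x xor (true xor y) ≡ true xor (x xor y)
    rearrange false y = P.refl
    rearrange true  y = P.refl

  shorter⇒inverts : ∀ {t} → Reflection t → ∀ {w} → ℓ (w ∙ t) < ℓ w → inverts w t ≡ true
  shorter⇒inverts {t} t∈T {w} ℓwt<ℓw = by-cases (inverts (w ∙ t) t) P.refl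
    where
    wtt≈w : w ∙ t ∙ t ≈ w
    wtt≈w = trans (assoc _ _ _) (trans (∙-congˡ (reflection-involution t∈T)) (identityʳ w))
    ttt≈t : conj t t ≈ t
    ttt≈t = solve (involution t (reflection-involution t∈T) ∷ᵥ []ᵥ) (X₀ ⊗ X₀ ⊗ inv X₀) X₀ P.refl
    by-cases : ∀ b → inverts (w ∙ t) t ≡ b → inverts w t ≡ true
    by-cases true  wt-inverts = ⊥-elim (<-asym ℓwt<ℓw
      (P.subst (_< ℓ (w ∙ t)) (ℓ-cong wtt≈w) (inverts⇒shorter wt-inverts)))
    by-cases false wt-inverts = begin
      inverts w t                                 ≡⟨ inverts-cong (sym wtt≈w) refl ⟩
      inverts (w ∙ t ∙ t) t                       ≡⟨ inverts-∙ (w ∙ t) t t ⟩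
      inverts t t xor inverts (w ∙ t) (conj t t)  ≡⟨ P.cong₂ _xor_ (inverts-self t∈T) (inverts-cong refl ttt≈t) ⟩
      true xor inverts (w ∙ t) t                  ≡⟨ P.cong (true xor_) wt-inverts ⟩
      true                                        ∎
      where open P.≡-Reasoning

  -- t inverts w = s (s w); by the cocycle rule either (s w) t (s w)⁻¹ = s, which gives s v = w,
  -- or t inverts s w, which would make s v = (s w) t shorter than v.
  exchange : ∀ {s t v w} → S s → Reflection t → w ≈ v ∙ t → ℓ w ≡ suc (ℓ v) →
             ℓ (s ∙ w) < ℓ w → ℓ v < ℓ (s ∙ v) → s ∙ v ≈ w
  exchange {s} {t} {v} {w} s∈S t∈T w≈vt ℓw≡1+ℓv ℓsw<ℓw ℓv<ℓsv = by-cases (conj (s ∙ w) t ≈? s)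
    where
    v≈wt : v ≈ w ∙ t
    v≈wt = trans (solve (plain v ∷ᵥ involution t (reflection-involution t∈T) ∷ᵥ []ᵥ) X₀ (X₀ ⊗ X₁ ⊗ X₁) P.refl)
                 (∙-congʳ (sym w≈vt))
    sv≈[sw]t : s ∙ v ≈ s ∙ w ∙ t
    sv≈[sw]t = trans (∙-congˡ v≈wt) (sym (assoc s w t))
    by-cases : Dec (conj (s ∙ w) t ≈ s) → s ∙ v ≈ w
    by-cases (yes swt[sw]⁻¹≈s) = begin
      s ∙ v                     ≈⟨ sv≈[sw]t ⟩
      s ∙ w ∙ t                 ≈⟨ solve (plain s ∷ᵥ plain w ∷ᵥ plain t ∷ᵥ []ᵥ)
                                     (X₀ ⊗ X₁ ⊗ X₂) (X₀ ⊗ X₁ ⊗ X₂ ⊗ inv (X₀ ⊗ X₁) ⊗ (X₀ ⊗ X₁)) P.refl ⟩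
      conj (s ∙ w) t ∙ (s ∙ w)  ≈⟨ ∙-congʳ swt[sw]⁻¹≈s ⟩
      s ∙ (s ∙ w)               ≈⟨ generator-cancelˡ s∈S w ⟩
      w                         ∎
      where open SetoidReasoning setoid
    by-cases (no swt[sw]⁻¹≉s) = ⊥-elim (<-asym ℓv<ℓsv (begin-strict
      ℓ (s ∙ v)        ≡⟨ ℓ-cong sv≈[sw]t ⟩
      ℓ (s ∙ w ∙ t)    <⟨ inverts⇒shorter sw-inverts ⟩
      ℓ (s ∙ w)        ≤⟨ s≤s⁻¹ (≤-trans ℓsw<ℓw (≤-reflexive ℓw≡1+ℓv)) ⟩
      ℓ v              ∎))
      where
      open ≤-Reasoning
      w-inverts : inverts w t ≡ true
      w-inverts = shorter⇒inverts t∈T (P.subst (_< ℓ w) (ℓ-cong v≈wt) (≤-reflexive (P.sym ℓw≡1+ℓv)))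
      sw-inverts : inverts (s ∙ w) t ≡ true
      sw-inverts = P.trans (P.sym (xor-identityʳ _))
        (P.trans (P.cong (inverts (s ∙ w) t xor_) (P.sym (dec-false (conj (s ∙ w) t ≈? s) swt[sw]⁻¹≉s)))
          (P.trans (P.sym (inverts-s∙ s∈S (s ∙ w) t))
            (P.trans (inverts-cong (generator-cancelˡ s∈S w) refl) w-inverts)))

module BruhatOrder (T : TwistedCoxeterSystem) (ℓ : TCS.Carrier T → ℕ)
                   (isLength : TCS.IsLengthFunction T ℓ) where
  open TCS T
  open IsCoxeterSystem isCoxeter
  open GroupProperties W
  open GroupWords W
  open CoxeterGroup T ℓ isLength
  open ReflectionCocycle T ℓ isLength using (exchange)

  infix 4 _≤ᴮ_
  _≤ᴮ_ : Carrier → Carrier → Set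
  _≤ᴮ_ = Bruhat ℓ

  ≤ᴮ-respʳ : ∀ {u v v'} → u ≤ᴮ v → v ≈ v' → u ≤ᴮ v'
  ≤ᴮ-respʳ (bruhat-refl u≈v) v≈v' = bruhat-refl (trans u≈v v≈v')
  ≤ᴮ-respʳ (bruhat-step {v = v'} u≤v' t∈T v≈v't ℓv'<ℓv) v≈v'' =
    bruhat-step u≤v' t∈T (trans (sym v≈v'') v≈v't) (P.subst (ℓ v' <_) (ℓ-cong v≈v'') ℓv'<ℓv)

  ≤ᴮ-trans : ∀ {u v w} → u ≤ᴮ v → v ≤ᴮ w → u ≤ᴮ w
  ≤ᴮ-trans u≤v (bruhat-refl v≈w)                    = ≤ᴮ-respʳ u≤v v≈w
  ≤ᴮ-trans u≤v (bruhat-step v≤w' t∈T w≈w't ℓw'<ℓw) = bruhat-step (≤ᴮ-trans u≤v v≤w') t∈T w≈w't ℓw'<ℓw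

  bruhatPreorder : Preorder 0ℓ 0ℓ 0ℓ
  bruhatPreorder = record
    { Carrier = Carrier ; _≈_ = _≈_ ; _≲_ = _≤ᴮ_
    ; isPreorder = record { isEquivalence = isEquivalence ; reflexive = bruhat-refl ; trans = ≤ᴮ-trans } }

  ≤ᴮ-∙reflection : ∀ {t v} → Reflection t → ℓ v < ℓ (v ∙ t) → v ≤ᴮ v ∙ t
  ≤ᴮ-∙reflection t∈T ℓv<ℓvt = bruhat-step (bruhat-refl refl) t∈T refl ℓv<ℓvt

  ≤ᴮ-reflection∙ : ∀ {t v} → Reflection t → ℓ v < ℓ (t ∙ v) → v ≤ᴮ t ∙ v
  ≤ᴮ-reflection∙ {t} {v} t∈T ℓv<ℓtv = bruhat-step (bruhat-refl refl) (reflection-conj t∈T (v ⁻¹))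
    (solve (plain t ∷ᵥ plain v ∷ᵥ []ᵥ) (X₀ ⊗ X₁) (X₁ ⊗ (inv X₁ ⊗ X₀ ⊗ inv (inv X₁))) P.refl) ℓv<ℓtv

  ε-≤ᴮ : ∀ a → ε ≤ᴮ a
  ε-≤ᴮ a = go (ℓ a) a P.refl
    where
    go : ∀ k a → ℓ a ≡ k → ε ≤ᴮ a
    go zero    a ℓa≡0   = bruhat-refl (sym (ℓ≡0⇒≈ε ℓa≡0))
    go (suc k) a ℓa≡1+k = from-factor (rightFactor ℓa≡1+k)
      where
      from-factor : RightFactor a k → ε ≤ᴮ a
      from-factor (s , s∈S , a' , a≈a's , ℓa'≡k) = bruhat-step (go k a' ℓa'≡k) (generator⇒reflection s∈S) a≈a's
        (≤-reflexive (P.trans (P.cong suc ℓa'≡k) (P.sym ℓa≡1+k)))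

  ≤ᴮ-ε : ∀ {u} → u ≤ᴮ ε → u ≈ ε
  ≤ᴮ-ε (bruhat-refl u≈ε) = u≈ε
  ≤ᴮ-ε (bruhat-step {v = v} _ _ _ ℓv<ℓε) with P.subst (ℓ v <_) ℓ-ε ℓv<ℓε
  ... | ()

  ≤ᴮ-⁻¹ : ∀ {u v} → u ≤ᴮ v → u ⁻¹ ≤ᴮ v ⁻¹
  ≤ᴮ-⁻¹ (bruhat-refl u≈v) = bruhat-refl (⁻¹-cong u≈v)
  ≤ᴮ-⁻¹ {v = w} (bruhat-step {v = v} {t = t} u≤v t∈T w≈vt ℓv<ℓw) =
    bruhat-step (≤ᴮ-⁻¹ u≤v) (reflection-conj t∈T v) w⁻¹≈v⁻¹[vtv⁻¹]
      (P.subst₂ _<_ (P.sym (ℓ-⁻¹ v)) (P.sym (ℓ-⁻¹ w)) ℓv<ℓw)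
    where
    w⁻¹≈v⁻¹[vtv⁻¹] : w ⁻¹ ≈ v ⁻¹ ∙ conj v t
    w⁻¹≈v⁻¹[vtv⁻¹] = trans (⁻¹-cong w≈vt) (trans (⁻¹-anti-homo-∙ v t)
      (trans (∙-congʳ (sym (inverseʳ-unique t t (reflection-involution t∈T))))
        (solve (plain v ∷ᵥ plain t ∷ᵥ []ᵥ) (X₁ ⊗ inv X₀) (inv X₀ ⊗ (X₀ ⊗ X₁ ⊗ inv X₀)) P.refl)))

  covers⇒monotone : (f : Carrier → Carrier) → (∀ {a b} → a ≈ b → f a ≈ f b) →
               (∀ {t v} → Reflection t → ℓ v < ℓ (v ∙ t) → f v ≤ᴮ f (v ∙ t)) →
               ∀ {u v} → u ≤ᴮ v → f u ≤ᴮ f v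
  covers⇒monotone f f-cong f-cover (bruhat-refl u≈v) = bruhat-refl (f-cong u≈v)
  covers⇒monotone f f-cong f-cover (bruhat-step {v = v} u≤v t∈T w≈vt ℓv<ℓw) =
    ≤ᴮ-trans (covers⇒monotone f f-cong f-cover u≤v)
      (≤ᴮ-respʳ (f-cover t∈T (P.subst (ℓ v <_) (ℓ-cong w≈vt) ℓv<ℓw)) (f-cong (sym w≈vt)))

  -- ℓ (s v) and ℓ (s v t) differ in parity; if the latter is smaller, v → v t is a cover and
  -- the exchange condition applies.
  lifting : ∀ {s t v} → S s → Reflection t → ℓ v < ℓ (v ∙ t) →
            ℓ v < ℓ (s ∙ v) → ℓ (s ∙ (v ∙ t)) < ℓ (v ∙ t) →
            s ∙ v ≈ v ∙ t ⊎ ℓ (s ∙ v) < ℓ (s ∙ (v ∙ t))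
  lifting {s} {t} {v} s∈S t∈T ℓv<ℓvt ℓv<ℓsv ℓsvt<ℓvt with <-cmp (ℓ (s ∙ v)) (ℓ (s ∙ (v ∙ t)))
  ... | tri< ℓsv<ℓsvt _ _ = inj₂ ℓsv<ℓsvt
  ... | tri≈ _ ℓsv≡ℓsvt _ =
    ⊥-elim (ℓ-∙reflection≢ t∈T (s ∙ v) (P.trans (ℓ-cong (assoc s v t)) (P.sym ℓsv≡ℓsvt)))
  ... | tri> _ _ ℓsvt<ℓsv = inj₁ (exchange s∈S t∈T refl cover ℓsvt<ℓvt ℓv<ℓsv)
    where
    cover : ℓ (v ∙ t) ≡ suc (ℓ v)
    cover = ≤-antisym (begin
      ℓ (v ∙ t)              ≤⟨ P.subst (_≤ suc (ℓ (s ∙ (v ∙ t)))) (ℓ-cong (generator-cancelˡ s∈S (v ∙ t)))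
                                  (ℓ-s∙ s∈S (s ∙ (v ∙ t))) ⟩
      suc (ℓ (s ∙ (v ∙ t)))  ≤⟨ ℓsvt<ℓsv ⟩
      ℓ (s ∙ v)              ≤⟨ ℓ-s∙ s∈S v ⟩
      suc (ℓ v)              ∎) ℓv<ℓvt
      where open ≤-Reasoning

module DemazureProduct (T : TwistedCoxeterSystem) (ℓ : TCS.Carrier T → ℕ)
                       (isLength : TCS.IsLengthFunction T ℓ)
                       (_⊙_ : TCS.Carrier T → TCS.Carrier T → TCS.Carrier T)
                       (isDemazure : TCS.IsDemazureProduct T ℓ _⊙_) where
  open TCS T
  open IsCoxeterSystem isCoxeter
  open IsDemazureProduct isDemazure
  open GroupProperties W
  open GroupWords W
  open CoxeterGroup T ℓ isLength
  open BruhatOrder T ℓ isLength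

  ⊙-generatorˡ : ∀ {s} → S s → ∀ a → (s ⊙ a ≈ s ∙ a × suc (ℓ a) ≡ ℓ (s ∙ a))
                                   ⊎ (s ⊙ a ≈ a × suc (ℓ (s ∙ a)) ≡ ℓ a)
  ⊙-generatorˡ s∈S a with ℓ-s∙-cases s∈S a
  ... | inj₁ up   = inj₁ (⊙-left-up a s∈S (≤-reflexive up) , up)
  ... | inj₂ down = inj₂ (⊙-left-down a s∈S (λ lt → <-asym lt (≤-reflexive down)) , down)

  ⊙-generatorʳ : ∀ {s} → S s → ∀ a → (a ⊙ s ≈ a ∙ s × suc (ℓ a) ≡ ℓ (a ∙ s))
                                   ⊎ (a ⊙ s ≈ a × suc (ℓ (a ∙ s)) ≡ ℓ a)
  ⊙-generatorʳ s∈S a with ℓ-∙s-cases s∈S a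
  ... | inj₁ up   = inj₁ (⊙-right-up a s∈S (≤-reflexive up) , up)
  ... | inj₂ down = inj₂ (⊙-right-down a s∈S (λ lt → <-asym lt (≤-reflexive down)) , down)

  s∙-ascent : ∀ {s a} → S s → suc (ℓ a) ≡ ℓ (s ∙ a) → a ≤ᴮ s ∙ a
  s∙-ascent s∈S up = ≤ᴮ-reflection∙ (generator⇒reflection s∈S) (≤-reflexive up)

  s∙-descent : ∀ {s a} → S s → suc (ℓ (s ∙ a)) ≡ ℓ a → s ∙ a ≤ᴮ a
  s∙-descent {s} {a} s∈S down = ≤ᴮ-respʳ
    (s∙-ascent s∈S (P.trans down (P.sym (ℓ-cong (generator-cancelˡ s∈S a))))) (generator-cancelˡ s∈S a)

  ∙s-ascent : ∀ {s a} → S s → suc (ℓ a) ≡ ℓ (a ∙ s) → a ≤ᴮ a ∙ s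
  ∙s-ascent s∈S up = ≤ᴮ-∙reflection (generator⇒reflection s∈S) (≤-reflexive up)

  ∙s-descent : ∀ {s a} → S s → suc (ℓ (a ∙ s)) ≡ ℓ a → a ∙ s ≤ᴮ a
  ∙s-descent {s} {a} s∈S down = ≤ᴮ-respʳ
    (∙s-ascent s∈S (P.trans down (P.sym (ℓ-cong (generator-cancelʳ s∈S a))))) (generator-cancelʳ s∈S a)

  ≤ᴮ-s⊙ : ∀ {s} → S s → ∀ a → a ≤ᴮ s ⊙ a
  ≤ᴮ-s⊙ s∈S a with ⊙-generatorˡ s∈S a
  ... | inj₁ (s⊙a≈sa , up) = ≤ᴮ-respʳ (s∙-ascent s∈S up) (sym s⊙a≈sa)
  ... | inj₂ (s⊙a≈a  , _)  = bruhat-refl (sym s⊙a≈a)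

  s∙≤ᴮs⊙ : ∀ {s} → S s → ∀ a → s ∙ a ≤ᴮ s ⊙ a
  s∙≤ᴮs⊙ s∈S a with ⊙-generatorˡ s∈S a
  ... | inj₁ (s⊙a≈sa , _)    = bruhat-refl (sym s⊙a≈sa)
  ... | inj₂ (s⊙a≈a  , down) = ≤ᴮ-respʳ (s∙-descent s∈S down) (sym s⊙a≈a)

  ≤ᴮ-⊙s : ∀ {s} → S s → ∀ a → a ≤ᴮ a ⊙ s
  ≤ᴮ-⊙s s∈S a with ⊙-generatorʳ s∈S a
  ... | inj₁ (a⊙s≈as , up) = ≤ᴮ-respʳ (∙s-ascent s∈S up) (sym a⊙s≈as)
  ... | inj₂ (a⊙s≈a  , _)  = bruhat-refl (sym a⊙s≈a)

  ∙s≤ᴮ⊙s : ∀ {s} → S s → ∀ a → a ∙ s ≤ᴮ a ⊙ s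
  ∙s≤ᴮ⊙s s∈S a with ⊙-generatorʳ s∈S a
  ... | inj₁ (a⊙s≈as , _)    = bruhat-refl (sym a⊙s≈as)
  ... | inj₂ (a⊙s≈a  , down) = ≤ᴮ-respʳ (∙s-descent s∈S down) (sym a⊙s≈a)

  s⊙-cover : ∀ {s t v} → S s → Reflection t → ℓ v < ℓ (v ∙ t) → s ⊙ v ≤ᴮ s ⊙ (v ∙ t)
  s⊙-cover {s} {t} {v} s∈S t∈T ℓv<ℓvt with ⊙-generatorˡ s∈S v | ⊙-generatorˡ s∈S (v ∙ t)
  ... | inj₂ (s⊙v≈v , _) | _ = begin
    s ⊙ v        ≈⟨ s⊙v≈v ⟩
    v            ≲⟨ ≤ᴮ-∙reflection t∈T ℓv<ℓvt ⟩
    v ∙ t        ≲⟨ ≤ᴮ-s⊙ s∈S (v ∙ t) ⟩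
    s ⊙ (v ∙ t)  ∎
    where open PreorderReasoning bruhatPreorder
  ... | inj₁ (s⊙v≈sv , v-up) | inj₁ (s⊙vt≈svt , vt-up) = begin
    s ⊙ v        ≈⟨ s⊙v≈sv ⟩
    s ∙ v        ≲⟨ bruhat-step (bruhat-refl refl) t∈T (sym (assoc s v t))
                      (P.subst₂ _<_ v-up vt-up (s≤s ℓv<ℓvt)) ⟩
    s ∙ (v ∙ t)  ≈⟨ sym s⊙vt≈svt ⟩
    s ⊙ (v ∙ t)  ∎
    where open PreorderReasoning bruhatPreorder
  ... | inj₁ (s⊙v≈sv , v-up) | inj₂ (s⊙vt≈vt , vt-down)
      with lifting s∈S t∈T ℓv<ℓvt (≤-reflexive v-up) (≤-reflexive vt-down)
  ...   | inj₁ sv≈vt = bruhat-refl (trans s⊙v≈sv (trans sv≈vt (sym s⊙vt≈vt)))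
  ...   | inj₂ ℓsv<ℓsvt = begin
    s ⊙ v        ≈⟨ s⊙v≈sv ⟩
    s ∙ v        ≲⟨ bruhat-step (bruhat-refl refl) t∈T (sym (assoc s v t)) ℓsv<ℓsvt ⟩
    s ∙ (v ∙ t)  ≲⟨ s∙-descent s∈S vt-down ⟩
    v ∙ t        ≈⟨ sym s⊙vt≈vt ⟩
    s ⊙ (v ∙ t)  ∎
    where open PreorderReasoning bruhatPreorder

  -- the smaller of a and s a (s ⊙ a is the larger)
  lowerˡ : Carrier → Carrier → Carrier
  lowerˡ s a = s ∙ (s ⊙ a)

  lowerˡ-cover : ∀ {s t v} → S s → Reflection t → ℓ v < ℓ (v ∙ t) → lowerˡ s v ≤ᴮ lowerˡ s (v ∙ t)
  lowerˡ-cover {s} {t} {v} s∈S t∈T ℓv<ℓvt with ⊙-generatorˡ s∈S v | ⊙-generatorˡ s∈S (v ∙ t)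
  ... | inj₂ (s⊙v≈v , v-down) | inj₁ (s⊙vt≈svt , _) = begin
    s ∙ (s ⊙ v)        ≈⟨ ∙-congˡ s⊙v≈v ⟩
    s ∙ v              ≲⟨ s∙-descent s∈S v-down ⟩
    v                  ≲⟨ ≤ᴮ-∙reflection t∈T ℓv<ℓvt ⟩
    v ∙ t              ≈⟨ sym (trans (∙-congˡ s⊙vt≈svt) (generator-cancelˡ s∈S _)) ⟩
    s ∙ (s ⊙ (v ∙ t))  ∎
    where open PreorderReasoning bruhatPreorder
  ... | inj₂ (s⊙v≈v , v-down) | inj₂ (s⊙vt≈vt , vt-down) = begin
    s ∙ (s ⊙ v)        ≈⟨ ∙-congˡ s⊙v≈v ⟩
    s ∙ v              ≲⟨ bruhat-step (bruhat-refl refl) t∈T (sym (assoc s v t))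
                            (≤-pred (P.subst₂ _≤_ (P.cong suc (P.sym v-down)) (P.sym vt-down) ℓv<ℓvt)) ⟩
    s ∙ (v ∙ t)        ≈⟨ ∙-congˡ (sym s⊙vt≈vt) ⟩
    s ∙ (s ⊙ (v ∙ t))  ∎
    where open PreorderReasoning bruhatPreorder
  ... | inj₁ (s⊙v≈sv , _) | inj₁ (s⊙vt≈svt , _) = begin
    s ∙ (s ⊙ v)        ≈⟨ trans (∙-congˡ s⊙v≈sv) (generator-cancelˡ s∈S v) ⟩
    v                  ≲⟨ ≤ᴮ-∙reflection t∈T ℓv<ℓvt ⟩
    v ∙ t              ≈⟨ sym (trans (∙-congˡ s⊙vt≈svt) (generator-cancelˡ s∈S _)) ⟩
    s ∙ (s ⊙ (v ∙ t))  ∎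
    where open PreorderReasoning bruhatPreorder
  ... | inj₁ (s⊙v≈sv , v-up) | inj₂ (s⊙vt≈vt , vt-down)
      with lifting s∈S t∈T ℓv<ℓvt (≤-reflexive v-up) (≤-reflexive vt-down)
  ...   | inj₁ sv≈vt = bruhat-refl (begin-equality
    s ∙ (s ⊙ v)        ≈⟨ trans (∙-congˡ s⊙v≈sv) (generator-cancelˡ s∈S v) ⟩
    v                  ≈⟨ sym (generator-cancelˡ s∈S v) ⟩
    s ∙ (s ∙ v)        ≈⟨ ∙-congˡ (trans sv≈vt (sym s⊙vt≈vt)) ⟩
    s ∙ (s ⊙ (v ∙ t))  ∎)
    where open PreorderReasoning bruhatPreorder
  ...   | inj₂ ℓsv<ℓsvt = begin
    s ∙ (s ⊙ v)        ≈⟨ trans (∙-congˡ s⊙v≈sv) (generator-cancelˡ s∈S v) ⟩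
    v                  ≲⟨ s∙-ascent s∈S v-up ⟩
    s ∙ v              ≲⟨ bruhat-step (bruhat-refl refl) t∈T (sym (assoc s v t)) ℓsv<ℓsvt ⟩
    s ∙ (v ∙ t)        ≈⟨ ∙-congˡ (sym s⊙vt≈vt) ⟩
    s ∙ (s ⊙ (v ∙ t))  ∎
    where open PreorderReasoning bruhatPreorder

  s⊙-mono : ∀ {s u v} → S s → u ≤ᴮ v → s ⊙ u ≤ᴮ s ⊙ v
  s⊙-mono s∈S = covers⇒monotone _ (⊙-cong refl) (s⊙-cover s∈S)

  lowerˡ-mono : ∀ {s u v} → S s → u ≤ᴮ v → lowerˡ s u ≤ᴮ lowerˡ s v
  lowerˡ-mono s∈S = covers⇒monotone _ (λ a≈b → ∙-congˡ (⊙-cong refl a≈b)) (lowerˡ-cover s∈S)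

  ⊙s≈[s⊙⁻¹]⁻¹ : ∀ {s} → S s → ∀ a → a ⊙ s ≈ (s ⊙ (a ⁻¹)) ⁻¹
  ⊙s≈[s⊙⁻¹]⁻¹ {s} s∈S a = by-cases (ℓ a <? ℓ (a ∙ s))
    where
    open SetoidReasoning setoid
    as≈[sa⁻¹]⁻¹ : a ∙ s ≈ (s ∙ a ⁻¹) ⁻¹
    as≈[sa⁻¹]⁻¹ = solve (plain a ∷ᵥ involution s (S-invol s∈S) ∷ᵥ []ᵥ) (X₀ ⊗ X₁) (inv (X₁ ⊗ inv X₀)) P.refl
    ℓ-as≡ℓ-sa⁻¹ : ℓ (a ∙ s) ≡ ℓ (s ∙ a ⁻¹)
    ℓ-as≡ℓ-sa⁻¹ = P.trans (ℓ-cong as≈[sa⁻¹]⁻¹) (ℓ-⁻¹ _)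
    by-cases : Dec (ℓ a < ℓ (a ∙ s)) → a ⊙ s ≈ (s ⊙ (a ⁻¹)) ⁻¹
    by-cases (yes up) = begin
      a ⊙ s            ≈⟨ ⊙-right-up a s∈S up ⟩
      a ∙ s            ≈⟨ as≈[sa⁻¹]⁻¹ ⟩
      (s ∙ a ⁻¹) ⁻¹    ≈⟨ ⁻¹-cong (sym (⊙-left-up (a ⁻¹) s∈S (P.subst₂ _<_ (P.sym (ℓ-⁻¹ a)) ℓ-as≡ℓ-sa⁻¹ up))) ⟩
      (s ⊙ (a ⁻¹)) ⁻¹  ∎
    by-cases (no ¬up) = begin
      a ⊙ s            ≈⟨ ⊙-right-down a s∈S ¬up ⟩
      a                ≈⟨ sym (⁻¹-involutive a) ⟩
      a ⁻¹ ⁻¹          ≈⟨ ⁻¹-cong (sym (⊙-left-down (a ⁻¹) s∈S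
                            (λ up → ¬up (P.subst₂ _<_ (ℓ-⁻¹ a) (P.sym ℓ-as≡ℓ-sa⁻¹) up)))) ⟩
      (s ⊙ (a ⁻¹)) ⁻¹  ∎

  ⊙s-mono : ∀ {s u v} → S s → u ≤ᴮ v → u ⊙ s ≤ᴮ v ⊙ s
  ⊙s-mono {s} {u} {v} s∈S u≤v = begin
    u ⊙ s            ≈⟨ ⊙s≈[s⊙⁻¹]⁻¹ s∈S u ⟩
    (s ⊙ (u ⁻¹)) ⁻¹  ≲⟨ ≤ᴮ-⁻¹ (s⊙-mono s∈S (≤ᴮ-⁻¹ u≤v)) ⟩
    (s ⊙ (v ⁻¹)) ⁻¹  ≈⟨ sym (⊙s≈[s⊙⁻¹]⁻¹ s∈S v) ⟩
    v ⊙ s            ∎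
    where open PreorderReasoning bruhatPreorder

  ⊙s∙s-mono : ∀ {s u v} → S s → u ≤ᴮ v → u ⊙ s ∙ s ≤ᴮ v ⊙ s ∙ s
  ⊙s∙s-mono {s} {u} {v} s∈S u≤v = begin
    u ⊙ s ∙ s           ≈⟨ as-lowerˡ u ⟩
    lowerˡ s (u ⁻¹) ⁻¹  ≲⟨ ≤ᴮ-⁻¹ (lowerˡ-mono s∈S (≤ᴮ-⁻¹ u≤v)) ⟩
    lowerˡ s (v ⁻¹) ⁻¹  ≈⟨ sym (as-lowerˡ v) ⟩
    v ⊙ s ∙ s           ∎
    where
    open PreorderReasoning bruhatPreorder
    as-lowerˡ : ∀ a → a ⊙ s ∙ s ≈ lowerˡ s (a ⁻¹) ⁻¹
    as-lowerˡ a = trans (∙-congʳ (⊙s≈[s⊙⁻¹]⁻¹ s∈S a))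
      (solve (plain (s ⊙ (a ⁻¹)) ∷ᵥ involution s (S-invol s∈S) ∷ᵥ []ᵥ) (inv X₀ ⊗ X₁) (inv (X₁ ⊗ X₀)) P.refl)

  ⊙-leftFactor : ∀ {s a a' k} → S s → a ≈ s ∙ a' → ℓ a' ≡ k → ℓ a ≡ suc k → s ⊙ a' ≈ a
  ⊙-leftFactor {a' = a'} s∈S a≈sa' ℓa'≡k ℓa≡1+k =
    trans (⊙-left-up a' s∈S (≤-reflexive (P.trans (P.cong suc ℓa'≡k) (P.trans (P.sym ℓa≡1+k) (ℓ-cong a≈sa')))))
          (sym a≈sa')

  ⊙-rightFactor : ∀ {s a a' k} → S s → a ≈ a' ∙ s → ℓ a' ≡ k → ℓ a ≡ suc k → a' ⊙ s ≈ a
  ⊙-rightFactor {a' = a'} s∈S a≈a's ℓa'≡k ℓa≡1+k =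
    trans (⊙-right-up a' s∈S (≤-reflexive (P.trans (P.cong suc ℓa'≡k) (P.trans (P.sym ℓa≡1+k) (ℓ-cong a≈a's)))))
          (sym a≈a's)

  ε⊙generator : ∀ {s} → S s → ε ⊙ s ≈ s
  ε⊙generator {s} s∈S = trans (⊙-right-up ε s∈S (P.subst₂ _<_ (P.sym ℓ-ε) ℓ-εs≡1 (s≤s z≤n))) (identityˡ s)
    where
    ℓ-εs≡1 : 1 ≡ ℓ (ε ∙ s)
    ℓ-εs≡1 = P.sym (P.trans (ℓ-cong (identityˡ s)) (ℓ-generator s∈S))

  generator⊙ε : ∀ {s} → S s → s ⊙ ε ≈ s
  generator⊙ε {s} s∈S = trans (⊙-left-up ε s∈S (P.subst₂ _<_ (P.sym ℓ-ε) ℓ-sε≡1 (s≤s z≤n))) (identityʳ s)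
    where
    ℓ-sε≡1 : 1 ≡ ℓ (s ∙ ε)
    ℓ-sε≡1 = P.sym (P.trans (ℓ-cong (identityʳ s)) (ℓ-generator s∈S))

  generator⊙generator : ∀ {s t} → S s → S t → s ⊙ t ≈ t → s ≈ t
  generator⊙generator {s} {t} s∈S t∈S s⊙t≈t with ⊙-generatorʳ t∈S s
  ... | inj₂ (s⊙t≈s , _)  = trans (sym s⊙t≈s) s⊙t≈t
  ... | inj₁ (s⊙t≈st , _) = ⊥-elim (S-nontriv s∈S (begin
    s               ≈⟨ solve (plain s ∷ᵥ plain t ∷ᵥ []ᵥ) X₀ (X₀ ⊗ X₁ ⊗ inv X₁) P.refl ⟩
    s ∙ t ∙ t ⁻¹    ≈⟨ ∙-congʳ (trans (sym s⊙t≈st) s⊙t≈t) ⟩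
    t ∙ t ⁻¹        ≈⟨ inverseʳ t ⟩
    ε               ∎))
    where open SetoidReasoning setoid

  -- ε is a two-sided unit for ⊙ on W ∖ {ε}; the axioms leave ε ⊙ ε undetermined
  -- (on W = ℤ/2 the constant product with value s satisfies them).
  ε⊙ : ∀ {a k} → ℓ a ≡ suc k → ε ⊙ a ≈ a
  ε⊙ {a} ℓa≡1+k with leftFactor ℓa≡1+k
  ... | s , s∈S , a' , a≈sa' , ℓa'≡k = begin
    ε ⊙ a          ≈⟨ ⊙-cong refl (sym s⊙a'≈a) ⟩
    ε ⊙ (s ⊙ a')   ≈⟨ sym (⊙-assoc ε s a') ⟩
    (ε ⊙ s) ⊙ a'   ≈⟨ ⊙-cong (ε⊙generator s∈S) refl ⟩
    s ⊙ a'         ≈⟨ s⊙a'≈a ⟩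
    a              ∎
    where
    open SetoidReasoning setoid
    s⊙a'≈a : s ⊙ a' ≈ a
    s⊙a'≈a = ⊙-leftFactor s∈S a≈sa' ℓa'≡k ℓa≡1+k

  ⊙ε : ∀ {a k} → ℓ a ≡ suc k → a ⊙ ε ≈ a
  ⊙ε {a} {k} ℓa≡1+k = from-factor (rightFactor ℓa≡1+k)
    where
    open SetoidReasoning setoid
    from-factor : RightFactor a k → a ⊙ ε ≈ a
    from-factor (s , s∈S , a' , a≈a's , ℓa'≡k) = begin
      a ⊙ ε          ≈⟨ ⊙-cong (sym a'⊙s≈a) refl ⟩
      (a' ⊙ s) ⊙ ε   ≈⟨ ⊙-assoc a' s ε ⟩
      a' ⊙ (s ⊙ ε)   ≈⟨ ⊙-cong refl (generator⊙ε s∈S) ⟩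
      a' ⊙ s         ≈⟨ a'⊙s≈a ⟩
      a              ∎
      where
      a'⊙s≈a : a' ⊙ s ≈ a
      a'⊙s≈a = ⊙-rightFactor s∈S a≈a's ℓa'≡k ℓa≡1+k

  ⊙-reduced : ∀ {a b} → ℓ (a ∙ b) ≡ ℓ a + ℓ b → 0 < ℓ (a ∙ b) → a ⊙ b ≈ a ∙ b
  ⊙-reduced {a} {b} reduced 0<ℓab with ℓ a in ℓa
  ... | zero = ε-left (ℓ b) P.refl
    where
    a≈ε : a ≈ ε
    a≈ε = ℓ≡0⇒≈ε ℓa
    ε-left : ∀ n → ℓ b ≡ n → a ⊙ b ≈ a ∙ b
    ε-left zero    ℓb≡0   = ⊥-elim (<-irrefl P.refl (P.subst (0 <_) (P.trans reduced ℓb≡0) 0<ℓab))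
    ε-left (suc k) ℓb≡1+k = begin
      a ⊙ b  ≈⟨ ⊙-cong a≈ε refl ⟩
      ε ⊙ b  ≈⟨ ε⊙ ℓb≡1+k ⟩
      b      ≈⟨ sym (trans (∙-congʳ a≈ε) (identityˡ b)) ⟩
      a ∙ b  ∎
      where open SetoidReasoning setoid
  ... | suc j = go (ℓ b) b P.refl (P.subst (λ n → ℓ (a ∙ b) ≡ n + ℓ b) (P.sym ℓa) reduced)
    where
    go : ∀ k b → ℓ b ≡ k → ℓ (a ∙ b) ≡ ℓ a + k → a ⊙ b ≈ a ∙ b
    go zero    b ℓb≡0   _ = begin
      a ⊙ b   ≈⟨ ⊙-cong refl (ℓ≡0⇒≈ε ℓb≡0) ⟩
      a ⊙ ε   ≈⟨ ⊙ε ℓa ⟩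
      a       ≈⟨ sym (trans (∙-congˡ (ℓ≡0⇒≈ε ℓb≡0)) (identityʳ a)) ⟩
      a ∙ b   ∎
      where open SetoidReasoning setoid
    go (suc k) b ℓb≡1+k reduced = from-factor (rightFactor ℓb≡1+k)
      where
      from-factor : RightFactor b k → a ⊙ b ≈ a ∙ b
      from-factor (s , s∈S , b' , b≈b's , ℓb'≡k) = begin
        a ⊙ b          ≈⟨ ⊙-cong refl (sym (⊙-rightFactor s∈S b≈b's ℓb'≡k ℓb≡1+k)) ⟩
        a ⊙ (b' ⊙ s)   ≈⟨ sym (⊙-assoc a b' s) ⟩
        (a ⊙ b') ⊙ s   ≈⟨ ⊙-cong (go k b' ℓb'≡k ℓab'≡) refl ⟩
        (a ∙ b') ⊙ s   ≈⟨ ⊙-right-up (a ∙ b') s∈S ab'-up ⟩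
        a ∙ b' ∙ s     ≈⟨ ab's≈ab ⟩
        a ∙ b          ∎
        where
        open SetoidReasoning setoid
        ab's≈ab : a ∙ b' ∙ s ≈ a ∙ b
        ab's≈ab = trans (assoc a b' s) (∙-congˡ (sym b≈b's))
        ℓab's≡ : suc (ℓ a + k) ≡ ℓ (a ∙ b' ∙ s)
        ℓab's≡ = P.trans (P.sym (+-suc (ℓ a) k)) (P.trans (P.sym reduced) (ℓ-cong (sym ab's≈ab)))
        ℓab'≡ : ℓ (a ∙ b') ≡ ℓ a + k
        ℓab'≡ = ≤-antisym (≤-trans (ℓ-∙ a b') (≤-reflexive (P.cong (ℓ a +_) ℓb'≡k)))
          (s≤s⁻¹ (≤-trans (≤-reflexive ℓab's≡) (ℓ-∙s s∈S (a ∙ b'))))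
        ab'-up : ℓ (a ∙ b') < ℓ (a ∙ b' ∙ s)
        ab'-up = ≤-reflexive (P.trans (P.cong suc ℓab'≡) ℓab's≡)

  ℓ-⊙s : ∀ {s} → S s → ∀ a → ℓ (a ⊙ s) ≤ suc (ℓ a)
  ℓ-⊙s s∈S a with ⊙-generatorʳ s∈S a
  ... | inj₁ (a⊙s≈as , up) = ≤-reflexive (P.trans (ℓ-cong a⊙s≈as) (P.sym up))
  ... | inj₂ (a⊙s≈a  , _)  = ≤-trans (≤-reflexive (ℓ-cong a⊙s≈a)) (n≤1+n _)

  ⊙s∙s-ascent : ∀ {s a} → S s → suc (ℓ a) ≡ ℓ (a ∙ s) → a ⊙ s ∙ s ≈ a
  ⊙s∙s-ascent {s} {a} s∈S up = trans (∙-congʳ (⊙-right-up a s∈S (≤-reflexive up))) (generator-cancelʳ s∈S a)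

  ⊙s∙s-descent : ∀ {s a} → S s → suc (ℓ (a ∙ s)) ≡ ℓ a → a ⊙ s ∙ s ≈ a ∙ s
  ⊙s∙s-descent {s} {a} s∈S down = ∙-congʳ (⊙-right-down a s∈S (λ up → <-asym up (≤-reflexive down)))

  ⊙s∙s-cases : ∀ {s} → S s → ∀ a → a ⊙ s ∙ s ≈ a ⊎ a ⊙ s ∙ s ≈ a ∙ s
  ⊙s∙s-cases s∈S a with ℓ-∙s-cases s∈S a
  ... | inj₁ up   = inj₁ (⊙s∙s-ascent s∈S up)
  ... | inj₂ down = inj₂ (⊙s∙s-descent s∈S down)

  ⊙s∙s≤ᴮ∙s : ∀ {s} → S s → ∀ a → a ⊙ s ∙ s ≤ᴮ a ∙ s
  ⊙s∙s≤ᴮ∙s s∈S a with ℓ-∙s-cases s∈S a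
  ... | inj₁ up   = ≤ᴮ-trans (bruhat-refl (⊙s∙s-ascent s∈S up)) (∙s-ascent s∈S up)
  ... | inj₂ down = bruhat-refl (⊙s∙s-descent s∈S down)

module TwistedInvolutions (T : TwistedCoxeterSystem) (ℓ : TCS.Carrier T → ℕ)
                          (isLength : TCS.IsLengthFunction T ℓ)
                          (_⊙_ : TCS.Carrier T → TCS.Carrier T → TCS.Carrier T)
                          (isDemazure : TCS.IsDemazureProduct T ℓ _⊙_) where
  open TCS T
  open IsCoxeterSystem isCoxeter
  open IsDemazureProduct isDemazure
  open GroupProperties W
  open GroupWords W
  open CoxeterGroup T ℓ isLength
  open BruhatOrder T ℓ isLength
  open DemazureProduct T ℓ isLength _⊙_ isDemazure

  Twisted-resp : ∀ {a b} → a ≈ b → Twisted a → Twisted b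
  Twisted-resp a≈b a⁻¹≈a* = trans (⁻¹-cong (sym a≈b)) (trans a⁻¹≈a* (⋆.⟦⟧-cong a≈b))

  star⁻¹-∙s : ∀ {s} → S s → ∀ a → star (a ∙ s) ⁻¹ ≈ star s ∙ star a ⁻¹
  star⁻¹-∙s {s} s∈S a = trans (⁻¹-cong (⋆.homo a s))
    (solve (plain (star a) ∷ᵥ involution (star s) (S-invol (star-S s∈S)) ∷ᵥ []ᵥ) (inv (X₀ ⊗ X₁)) (X₁ ⊗ inv X₀) P.refl)

  ℓ-star⁻¹ : ∀ a → ℓ (star a ⁻¹) ≡ ℓ a
  ℓ-star⁻¹ a = P.trans (ℓ-⁻¹ (star a)) (ℓ-star a)

  star⁻¹-⊙s : ∀ {s} → S s → ∀ u → star (u ⊙ s) ⁻¹ ≈ star s ⊙ (star u ⁻¹)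
  star⁻¹-⊙s {s} s∈S u = by-cases (⊙-generatorʳ s∈S u)
    where
    ℓ-us≡ : ℓ (u ∙ s) ≡ ℓ (star s ∙ star u ⁻¹)
    ℓ-us≡ = P.trans (P.sym (ℓ-star⁻¹ (u ∙ s))) (ℓ-cong (star⁻¹-∙s s∈S u))
    by-cases : (u ⊙ s ≈ u ∙ s × suc (ℓ u) ≡ ℓ (u ∙ s)) ⊎ (u ⊙ s ≈ u × suc (ℓ (u ∙ s)) ≡ ℓ u) →
               star (u ⊙ s) ⁻¹ ≈ star s ⊙ (star u ⁻¹)
    by-cases (inj₁ (u⊙s≈us , up)) = trans (⁻¹-cong (⋆.⟦⟧-cong u⊙s≈us)) (trans (star⁻¹-∙s s∈S u)
      (sym (⊙-left-up (star u ⁻¹) (star-S s∈S) (P.subst₂ _<_ (P.sym (ℓ-star⁻¹ u)) ℓ-us≡ (≤-reflexive up)))))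
    by-cases (inj₂ (u⊙s≈u , down)) = trans (⁻¹-cong (⋆.⟦⟧-cong u⊙s≈u))
      (sym (⊙-left-down (star u ⁻¹) (star-S s∈S)
        λ up → <-asym up (P.subst₂ _<_ ℓ-us≡ (P.sym (ℓ-star⁻¹ u)) (≤-reflexive down))))

  ℓ-twisted-∙s : ∀ {s z} → S s → Twisted z → ℓ (z ∙ s) ≡ ℓ (star s ∙ z)
  ℓ-twisted-∙s {s} {z} s∈S z⁻¹≈z* = begin
    ℓ (z ∙ s)                  ≡⟨ P.sym (ℓ-⁻¹ _) ⟩
    ℓ ((z ∙ s) ⁻¹)             ≡⟨ ℓ-cong [zs]⁻¹≈star[s*z] ⟩
    ℓ (star (star s ∙ z))      ≡⟨ ℓ-star _ ⟩
    ℓ (star s ∙ z)             ∎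
    where
    open P.≡-Reasoning
    [zs]⁻¹≈star[s*z] : (z ∙ s) ⁻¹ ≈ star (star s ∙ z)
    [zs]⁻¹≈star[s*z] = trans
      (solve (plain z ∷ᵥ involution s (S-invol s∈S) ∷ᵥ []ᵥ) (inv (X₀ ⊗ X₁)) (X₁ ⊗ inv X₀) P.refl)
      (trans (∙-cong (sym (star-invol s)) z⁻¹≈z*) (sym (⋆.homo (star s) z)))

  -- The two ways in which (s* ⊙ z') ⊙ s can differ from a twisted involution z':
  -- the twisted conjugate s* z' s, or, when that equals z', the product z' s.
  data TwistedAscent (s z' z : Carrier) : Set where
    conjugate : z ≈ star s ∙ z' ∙ s → ℓ z ≡ 2 + ℓ z' → TwistedAscent s z' z
    multiply  : z ≈ z' ∙ s → star s ∙ z' ≈ z' ∙ s → ℓ z ≡ 1 + ℓ z' → TwistedAscent s z' z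

  twisted-ascent : ∀ {s z'} → S s → Twisted z' → ¬ ((star s ⊙ z') ⊙ s ≈ z') →
                   suc (ℓ z') ≡ ℓ (z' ∙ s) × TwistedAscent s z' ((star s ⊙ z') ⊙ s)
  twisted-ascent {s} {z'} s∈S z'-twisted z≉z' with ⊙-generatorˡ (star-S s∈S) z'
  ... | inj₂ (s*⊙z'≈z' , down) = ⊥-elim (z≉z' (trans (⊙-cong s*⊙z'≈z' refl)
          (⊙-right-down z' s∈S λ up → <-asym up
            (P.subst (_< ℓ z') (P.sym (ℓ-twisted-∙s s∈S z'-twisted)) (≤-reflexive down)))))
  ... | inj₁ (s*⊙z'≈s*z' , up) = z'-up , shape (⊙-generatorʳ s∈S (star s ∙ z'))
    where
    z'-up : suc (ℓ z') ≡ ℓ (z' ∙ s)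
    z'-up = P.trans up (P.sym (ℓ-twisted-∙s s∈S z'-twisted))
    z≈ : (star s ⊙ z') ⊙ s ≈ (star s ∙ z') ⊙ s
    z≈ = ⊙-cong s*⊙z'≈s*z' refl
    shape : ((star s ∙ z') ⊙ s ≈ star s ∙ z' ∙ s × suc (ℓ (star s ∙ z')) ≡ ℓ (star s ∙ z' ∙ s))
          ⊎ ((star s ∙ z') ⊙ s ≈ star s ∙ z' × suc (ℓ (star s ∙ z' ∙ s)) ≡ ℓ (star s ∙ z')) →
            TwistedAscent s z' ((star s ⊙ z') ⊙ s)
    shape (inj₁ (⊙s≈ , up')) = conjugate (trans z≈ ⊙s≈)
      (P.trans (ℓ-cong (trans z≈ ⊙s≈)) (P.trans (P.sym up') (P.cong suc (P.sym up))))
    shape (inj₂ (⊙s≈ , down')) = multiply z≈z's s*z'≈z's (P.trans (ℓ-cong z≈z's) (P.sym z'-up))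
      where
      open SetoidReasoning setoid
      z≈z's : (star s ⊙ z') ⊙ s ≈ z' ∙ s
      z≈z's = begin
        (star s ⊙ z') ⊙ s    ≈⟨ ⊙-assoc (star s) z' s ⟩
        star s ⊙ (z' ⊙ s)    ≈⟨ ⊙-cong refl (⊙-right-up z' s∈S (≤-reflexive z'-up)) ⟩
        star s ⊙ (z' ∙ s)    ≈⟨ ⊙-left-down (z' ∙ s) (star-S s∈S) (λ up'' → <-asym up''
                                  (≤-reflexive (P.trans (P.cong suc (ℓ-cong (sym (assoc (star s) z' s))))
                                    (P.trans down' (P.trans (P.sym up) z'-up))))) ⟩
        z' ∙ s               ∎
      s*z'≈z's : star s ∙ z' ≈ z' ∙ s
      s*z'≈z's = trans (sym ⊙s≈) (trans (sym z≈) z≈z's)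

  twisted-step : ∀ {s z'} → S s → Twisted z' → Twisted ((star s ⊙ z') ⊙ s)
  twisted-step {s} {z'} s∈S z'-twisted with (star s ⊙ z') ⊙ s ≈? z'
  ... | yes z≈z' = Twisted-resp (sym z≈z') z'-twisted
  ... | no z≉z' with proj₂ (twisted-ascent s∈S z'-twisted z≉z')
  ...   | conjugate z≈s*z's _ = Twisted-resp (sym z≈s*z's) (begin
    (star s ∙ z' ∙ s) ⁻¹             ≈⟨ solve (involution (star s) (S-invol (star-S s∈S)) ∷ᵥ plain z' ∷ᵥ
                                                 involution s (S-invol s∈S) ∷ᵥ []ᵥ)
                                          (inv (X₀ ⊗ X₁ ⊗ X₂)) (X₂ ⊗ inv X₁ ⊗ X₀) P.refl ⟩
    s ∙ z' ⁻¹ ∙ star s               ≈⟨ ∙-congʳ (∙-cong (sym (star-invol s)) z'-twisted) ⟩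
    star (star s) ∙ star z' ∙ star s ≈⟨ sym (trans (⋆.homo _ s) (∙-congʳ (⋆.homo (star s) z'))) ⟩
    star (star s ∙ z' ∙ s)           ∎)
    where open SetoidReasoning setoid
  ...   | multiply z≈z's s*z'≈z's _ = Twisted-resp (sym z≈z's) (begin
    (z' ∙ s) ⁻¹              ≈⟨ solve (plain z' ∷ᵥ involution s (S-invol s∈S) ∷ᵥ []ᵥ)
                                  (inv (X₀ ⊗ X₁)) (X₁ ⊗ inv X₀) P.refl ⟩
    s ∙ z' ⁻¹                ≈⟨ ∙-cong (sym (star-invol s)) z'-twisted ⟩
    star (star s) ∙ star z'  ≈⟨ sym (⋆.homo (star s) z') ⟩
    star (star s ∙ z')       ≈⟨ ⋆.⟦⟧-cong s*z'≈z's ⟩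
    star (z' ∙ s)            ∎)
    where open SetoidReasoning setoid

  -- An element absorbed on the left by every generator is ε or a *-invariant generator.
  ⊙-left-unit-on-S⇒twisted : ∀ {q} → (∀ {r} → S r → q ⊙ r ≈ r) → Twisted q
  ⊙-left-unit-on-S⇒twisted {q} q⊙r≈r = by-length (ℓ q) P.refl
    where
    by-length : ∀ n → ℓ q ≡ n → Twisted q
    by-length zero    ℓq≡0   = Twisted-resp (sym (ℓ≡0⇒≈ε ℓq≡0)) (trans ε⁻¹≈ε (sym ⋆.ε-homo))
    by-length (suc k) ℓq≡1+k = by-factor (rightFactor ℓq≡1+k)
      where
      by-factor : RightFactor q k → Twisted q
      by-factor (s , s∈S , q' , q≈q's , ℓq'≡k) = Twisted-resp (sym q≈s) s-twisted
        where
        ℓqs≡k : ℓ (q ∙ s) ≡ k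
        ℓqs≡k = P.trans (ℓ-cong (trans (∙-congʳ q≈q's) (generator-cancelʳ s∈S q'))) ℓq'≡k
        q≈s : q ≈ s
        q≈s = trans (sym (⊙-right-down q s∈S λ up → <-asym up (P.subst₂ _<_ (P.sym ℓqs≡k) (P.sym ℓq≡1+k) (n<1+n k))))
                    (q⊙r≈r s∈S)
        s-twisted : Twisted s
        s-twisted = trans (sym (inverseʳ-unique s s (S-invol s∈S)))
          (generator⊙generator s∈S (star-S s∈S) (trans (⊙-cong (sym q≈s) refl) (q⊙r≈r (star-S s∈S))))

  ε⊙ε⊙ε-twisted : Twisted ((ε ⊙ ε) ⊙ ε)
  ε⊙ε⊙ε-twisted = ⊙-left-unit-on-S⇒twisted λ {r} r∈S → begin
    ((ε ⊙ ε) ⊙ ε) ⊙ r  ≈⟨ ⊙-assoc (ε ⊙ ε) ε r ⟩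
    (ε ⊙ ε) ⊙ (ε ⊙ r)  ≈⟨ ⊙-cong refl (ε⊙generator r∈S) ⟩
    (ε ⊙ ε) ⊙ r        ≈⟨ ⊙-assoc ε ε r ⟩
    ε ⊙ (ε ⊙ r)        ≈⟨ ⊙-cong refl (ε⊙generator r∈S) ⟩
    ε ⊙ r              ≈⟨ ε⊙generator r∈S ⟩
    r                  ∎
    where open SetoidReasoning setoid

  module TwistedAction (x : Carrier) (x-twisted : Twisted x) where
    act : Carrier → Carrier
    act = twistAct _⊙_ x

    act-cong : ∀ {a b} → a ≈ b → act a ≈ act b
    act-cong a≈b = ⊙-cong (⊙-cong (⁻¹-cong (⋆.⟦⟧-cong a≈b)) refl) a≈b

    act-⊙s : ∀ {s} → S s → ∀ u → act (u ⊙ s) ≈ (star s ⊙ act u) ⊙ s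
    act-⊙s {s} s∈S u = begin
      ((star (u ⊙ s) ⁻¹) ⊙ x) ⊙ (u ⊙ s)        ≈⟨ ⊙-cong (⊙-cong (star⁻¹-⊙s s∈S u) refl) refl ⟩
      ((star s ⊙ (star u ⁻¹)) ⊙ x) ⊙ (u ⊙ s)   ≈⟨ sym (⊙-assoc _ u s) ⟩
      (((star s ⊙ (star u ⁻¹)) ⊙ x) ⊙ u) ⊙ s   ≈⟨ ⊙-cong (trans (⊙-cong (⊙-assoc _ _ x) refl)
                                                                 (⊙-assoc (star s) _ u)) refl ⟩
      (star s ⊙ act u) ⊙ s                     ∎
      where open SetoidReasoning setoid

    act-ε : act ε ≈ (ε ⊙ x) ⊙ ε
    act-ε = ⊙-cong (⊙-cong (trans (⁻¹-cong ⋆.ε-homo) ε⁻¹≈ε) refl) refl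

    act-ε≈x : ∀ {j} → ℓ x ≡ suc j → act ε ≈ x
    act-ε≈x ℓx≡1+j = trans act-ε (trans (⊙-cong (ε⊙ ℓx≡1+j) refl) (⊙ε ℓx≡1+j))

    act-ε-twisted : Twisted (act ε)
    act-ε-twisted = by-length (ℓ x) P.refl
      where
      by-length : ∀ n → ℓ x ≡ n → Twisted (act ε)
      by-length zero    ℓx≡0   = Twisted-resp (sym (trans act-ε (⊙-cong (⊙-cong refl (ℓ≡0⇒≈ε ℓx≡0)) refl)))
                                   ε⊙ε⊙ε-twisted
      by-length (suc j) ℓx≡1+j = Twisted-resp (sym (act-ε≈x ℓx≡1+j)) x-twisted

    act-twisted : ∀ w → Twisted (act w)
    act-twisted w = go (ℓ w) w P.refl
      where
      go : ∀ k w → ℓ w ≡ k → Twisted (act w)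
      go zero    w ℓw≡0   = Twisted-resp (act-cong (sym (ℓ≡0⇒≈ε ℓw≡0))) act-ε-twisted
      go (suc k) w ℓw≡1+k = by-factor (rightFactor ℓw≡1+k)
        where
        by-factor : RightFactor w k → Twisted (act w)
        by-factor (s , s∈S , w' , w≈w's , ℓw'≡k) = Twisted-resp
          (sym (trans (act-cong (sym (⊙-rightFactor s∈S w≈w's ℓw'≡k ℓw≡1+k))) (act-⊙s s∈S w')))
          (twisted-step s∈S (go k w' ℓw'≡k))

    Solution : Carrier → Carrier → Set
    Solution z w = InA ℓ _⊙_ x z w

    record Shortening (z w : Carrier) (m : ℕ) : Set where
      field
        s w'    : Carrier
        s∈S     : S s
        w≈w's   : w ≈ w' ∙ s
        ℓw≡1+m  : ℓ w ≡ suc m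
        ℓw'≡m   : ℓ w' ≡ m
        w'∈A    : Solution (act w') w'
        z'-up   : suc (ℓ (act w')) ≡ ℓ (act w' ∙ s)
        z≈      : z ≈ (star s ⊙ act w') ⊙ s
        ascent  : TwistedAscent s (act w') ((star s ⊙ act w') ⊙ s)

    shorten : ∀ {z w m} → Solution z w → ℓ w ≡ suc m → Shortening z w m
    shorten {z} {w} {m} w∈A ℓw≡1+m = from-factor (rightFactor ℓw≡1+m)
      where
      open InA w∈A
      from-factor : RightFactor w m → Shortening z w m
      from-factor (s , s∈S , w' , w≈w's , ℓw'≡m) = record
        { s = s ; w' = w' ; s∈S = s∈S ; w≈w's = w≈w's ; ℓw≡1+m = ℓw≡1+m ; ℓw'≡m = ℓw'≡m
        ; w'∈A = record { solves = refl ; minimal = minimal' }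
        ; z'-up = proj₁ ascent' ; z≈ = z≈ ; ascent = proj₂ ascent' }
        where
        z≈ : z ≈ (star s ⊙ act w') ⊙ s
        z≈ = trans (sym solves) (trans (act-cong (sym (⊙-rightFactor s∈S w≈w's ℓw'≡m ℓw≡1+m))) (act-⊙s s∈S w'))
        minimal' : ∀ w'' → act w'' ≈ act w' → ℓ w' ≤ ℓ w''
        minimal' w'' z''≈z' = s≤s⁻¹ (begin
          suc (ℓ w')   ≡⟨ P.trans (P.cong suc ℓw'≡m) (P.sym ℓw≡1+m) ⟩
          ℓ w          ≤⟨ minimal (w'' ⊙ s)
                               (trans (act-⊙s s∈S w'') (trans (⊙-cong (⊙-cong refl z''≈z') refl) (sym z≈))) ⟩
          ℓ (w'' ⊙ s)  ≤⟨ ℓ-⊙s s∈S w'' ⟩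
          suc (ℓ w'')  ∎)
          where open ≤-Reasoning
        z≉z' : ¬ ((star s ⊙ act w') ⊙ s ≈ act w')
        z≉z' z≈z' = <-irrefl P.refl (begin-strict
          ℓ w'   <⟨ ≤-reflexive (P.trans (P.cong suc ℓw'≡m) (P.sym ℓw≡1+m)) ⟩
          ℓ w    ≤⟨ minimal w' (sym (trans z≈ z≈z')) ⟩
          ℓ w'   ∎)
          where open ≤-Reasoning
        ascent' : suc (ℓ (act w')) ≡ ℓ (act w' ∙ s) × TwistedAscent s (act w') ((star s ⊙ act w') ⊙ s)
        ascent' = twisted-ascent s∈S (act-twisted w') z≉z'

    module Shortened {z w m} (sh : Shortening z w m) where
      open Shortening sh public

      z' u : Carrier
      z' = act w'
      u  = star w' ∙ z'

      star-w : star w ≈ star w' ∙ star s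
      star-w = trans (⋆.⟦⟧-cong w≈w's) (⋆.homo w' s)

      xw≈xw's : x ∙ w ≈ x ∙ w' ∙ s
      xw≈xw's = trans (∙-congˡ w≈w's) (sym (assoc x w' s))

      w*z-shape : (star w ∙ z ≈ u ∙ s × ℓ z ≡ 2 + ℓ z') ⊎ (star w ∙ z ≈ u × ℓ z ≡ 1 + ℓ z')
      w*z-shape with ascent
      ... | conjugate z≈s*z's ℓ≡ = inj₁ (w*z≈ , P.trans (ℓ-cong z≈) ℓ≡)
        where
        w*z≈ : star w ∙ z ≈ u ∙ s
        w*z≈ = trans (∙-cong star-w (trans z≈ z≈s*z's))
          (solve (plain (star w') ∷ᵥ involution (star s) (S-invol (star-S s∈S)) ∷ᵥ plain z' ∷ᵥ plain s ∷ᵥ []ᵥ)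
            (X₀ ⊗ X₁ ⊗ (X₁ ⊗ X₂ ⊗ X₃)) (X₀ ⊗ X₂ ⊗ X₃) P.refl)
      ... | multiply z≈z's s*z'≈z's ℓ≡ = inj₂ (w*z≈ , P.trans (ℓ-cong z≈) ℓ≡)
        where
        w*z≈ : star w ∙ z ≈ u
        w*z≈ = trans (∙-cong star-w (trans z≈ (trans z≈z's (sym s*z'≈z's))))
          (solve (plain (star w') ∷ᵥ involution (star s) (S-invol (star-S s∈S)) ∷ᵥ plain z' ∷ᵥ []ᵥ)
            (X₀ ⊗ X₁ ⊗ (X₁ ⊗ X₂)) (X₀ ⊗ X₂) P.refl)

      -- If x w' s were shorter than x w', then z' = w'*⁻¹ ⊙ x w' would absorb s on the right.
      x∙w'-up : ℓ (x ∙ w') ≡ ℓ x + ℓ w' → suc (ℓ (x ∙ w')) ≡ ℓ (x ∙ w' ∙ s)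
      x∙w'-up reduced with ℓ-∙s-cases s∈S (x ∙ w')
      ... | inj₁ up   = up
      ... | inj₂ down = ⊥-elim (<-irrefl (ℓ-cong (sym z's≈z')) (≤-reflexive z'-up))
        where
        open SetoidReasoning setoid
        v = x ∙ w'
        a = star w' ⁻¹
        z'≈a⊙v : z' ≈ a ⊙ v
        z'≈a⊙v = trans (⊙-assoc a x w') (⊙-cong refl (⊙-reduced reduced (≤-trans (s≤s z≤n) (≤-reflexive down))))
        z's≈z' : z' ∙ s ≈ z'
        z's≈z' = begin
          z' ∙ s        ≈⟨ sym (⊙-right-up z' s∈S (≤-reflexive z'-up)) ⟩
          z' ⊙ s        ≈⟨ ⊙-cong z'≈a⊙v refl ⟩
          (a ⊙ v) ⊙ s   ≈⟨ ⊙-assoc a v s ⟩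
          a ⊙ (v ⊙ s)   ≈⟨ ⊙-cong refl (⊙-right-down v s∈S (λ up → <-asym up (≤-reflexive down))) ⟩
          a ⊙ v         ≈⟨ sym z'≈a⊙v ⟩
          z'            ∎

    star≈ε∙ : ∀ {w} → w ≈ ε → ∀ a → star w ∙ a ≈ a
    star≈ε∙ w≈ε a = trans (∙-congʳ (trans (⋆.⟦⟧-cong w≈ε) ⋆.ε-homo)) (identityˡ a)

    ∙≈ε : ∀ {w} → w ≈ ε → ∀ a → a ∙ w ≈ a
    ∙≈ε w≈ε a = trans (∙-congˡ w≈ε) (identityʳ a)

    solution-induction : (Goal : Carrier → Carrier → Set) →
      (∀ {z w} → Solution z w → w ≈ ε → Goal z w) →
      (∀ {z w m} (sh : Shortening z w m) → let open Shortening sh in Goal (act w') w' → Goal z w) →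
      ∀ {z w} → Solution z w → Goal z w
    solution-induction Goal base step {w = w} = go (ℓ w) P.refl
      where
      go : ∀ k {z w} → ℓ w ≡ k → Solution z w → Goal z w
      go zero    ℓw≡0   w∈A = base w∈A (ℓ≡0⇒≈ε ℓw≡0)
      go (suc m) {z} {w} ℓw≡1+m w∈A = continue (shorten w∈A ℓw≡1+m)
        where
        continue : Shortening z w m → Goal z w
        continue sh = step sh (go m (Shortening.ℓw'≡m sh) (Shortening.w'∈A sh))

    SolutionLengths : Carrier → Carrier → Set
    SolutionLengths z w = ℓ (x ∙ w) ≡ ℓ x + ℓ w × ℓ (star w ∙ z) + ℓ w ≤ ℓ z

    solution-lengths-ε : ∀ {z w} → Solution z w → w ≈ ε → SolutionLengths z w
    solution-lengths-ε {z} {w} _ w≈ε = reduced , bound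
      where
      ℓw≡0 : ℓ w ≡ 0
      ℓw≡0 = P.trans (ℓ-cong w≈ε) ℓ-ε
      reduced : ℓ (x ∙ w) ≡ ℓ x + ℓ w
      reduced = P.trans (ℓ-cong (∙≈ε w≈ε x)) (P.sym (P.trans (P.cong (ℓ x +_) ℓw≡0) (+-identityʳ _)))
      bound : ℓ (star w ∙ z) + ℓ w ≤ ℓ z
      bound = ≤-reflexive (P.trans (P.cong₂ _+_ (ℓ-cong (star≈ε∙ w≈ε z)) ℓw≡0) (+-identityʳ _))

    solution-lengths-step : ∀ {z w m} (sh : Shortening z w m) → let open Shortening sh in
                            SolutionLengths (act w') w' → SolutionLengths z w
    solution-lengths-step {z} {w} {m} sh (IH-reduced , IH-bound) = reduced , bound
      where
      open Shortened sh
      ℓu+m≤ℓz' : ℓ u + m ≤ ℓ z'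
      ℓu+m≤ℓz' = P.subst (λ k → ℓ u + k ≤ ℓ z') ℓw'≡m IH-bound
      reduced : ℓ (x ∙ w) ≡ ℓ x + ℓ w
      reduced = begin-equality
        ℓ (x ∙ w)         ≡⟨ ℓ-cong xw≈xw's ⟩
        ℓ (x ∙ w' ∙ s)    ≡⟨ P.sym (x∙w'-up IH-reduced) ⟩
        suc (ℓ (x ∙ w'))  ≡⟨ P.cong suc IH-reduced ⟩
        suc (ℓ x + ℓ w')  ≡⟨ P.sym (+-suc (ℓ x) (ℓ w')) ⟩
        ℓ x + suc (ℓ w')  ≡⟨ P.cong (ℓ x +_) (P.trans (P.cong suc ℓw'≡m) (P.sym ℓw≡1+m)) ⟩
        ℓ x + ℓ w         ∎
        where open ≤-Reasoning
      bound : ℓ (star w ∙ z) + ℓ w ≤ ℓ z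
      bound with w*z-shape
      ... | inj₁ (w*z≈us , ℓz≡) = begin
        ℓ (star w ∙ z) + ℓ w      ≡⟨ P.cong₂ _+_ (ℓ-cong w*z≈us) ℓw≡1+m ⟩
        ℓ (u ∙ s) + suc m         ≤⟨ +-monoˡ-≤ (suc m) (ℓ-∙s s∈S u) ⟩
        suc (ℓ u) + suc m         ≡⟨ P.cong suc (+-suc (ℓ u) m) ⟩
        suc (suc (ℓ u + m))       ≤⟨ s≤s (s≤s ℓu+m≤ℓz') ⟩
        suc (suc (ℓ z'))          ≡⟨ P.sym ℓz≡ ⟩
        ℓ z                       ∎
        where open ≤-Reasoning
      ... | inj₂ (w*z≈u , ℓz≡) = begin
        ℓ (star w ∙ z) + ℓ w      ≡⟨ P.cong₂ _+_ (ℓ-cong w*z≈u) ℓw≡1+m ⟩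
        ℓ u + suc m               ≡⟨ +-suc (ℓ u) m ⟩
        suc (ℓ u + m)             ≤⟨ s≤s ℓu+m≤ℓz' ⟩
        suc (ℓ z')                ≡⟨ P.sym ℓz≡ ⟩
        ℓ z                       ∎
        where open ≤-Reasoning

    solution-lengths : ∀ {z w} → Solution z w → SolutionLengths z w
    solution-lengths = solution-induction SolutionLengths solution-lengths-ε solution-lengths-step

    PartA : Carrier → Carrier → Set
    PartA z w = ∀ y → star w ∙ y ≤ᴮ x ∙ w → y ≤ᴮ z

    -- For x = ε the value act ε = (ε ⊙ ε) ⊙ ε is not determined, but then y ≤ x forces y = ε.
    part-a-ε : ∀ {z w} → Solution z w → w ≈ ε → PartA z w
    part-a-ε {z} {w} w∈A w≈ε y w*y≤xw = ≤ᴮ-respʳ (below-act-ε y≤x) (trans (act-cong (sym w≈ε)) (InA.solves w∈A))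
      where
      y≤x : y ≤ᴮ x
      y≤x = begin
        y               ≈⟨ sym (star≈ε∙ w≈ε y) ⟩
        star w ∙ y      ≲⟨ w*y≤xw ⟩
        x ∙ w           ≈⟨ ∙≈ε w≈ε x ⟩
        x               ∎
        where open PreorderReasoning bruhatPreorder
      below-act-ε : y ≤ᴮ x → y ≤ᴮ act ε
      below-act-ε y≤x with ℓ x in ℓx
      ... | zero  = ≤ᴮ-trans (bruhat-refl (≤ᴮ-ε (≤ᴮ-respʳ y≤x (ℓ≡0⇒≈ε ℓx)))) (ε-≤ᴮ _)
      ... | suc j = ≤ᴮ-respʳ y≤x (sym (act-ε≈x ℓx))

    part-a-step : ∀ {z w m} (sh : Shortening z w m) → let open Shortening sh in PartA (act w') w' → PartA z w
    part-a-step {z} {w} sh IH y w*y≤xw = by-cases (⊙s∙s-cases s∈S U)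
      where
      open Shortened sh
      open PreorderReasoning bruhatPreorder
      v U : Carrier
      v = x ∙ w'
      U = star w' ∙ (star s ∙ y)
      v-up : suc (ℓ (v ∙ s ∙ s)) ≡ ℓ (v ∙ s)
      v-up = P.trans (P.cong suc (ℓ-cong (generator-cancelʳ s∈S v)))
        (x∙w'-up (proj₁ (solution-lengths w'∈A)))
      U⊙s∙s≤v : U ⊙ s ∙ s ≤ᴮ v
      U⊙s∙s≤v = begin
        U ⊙ s ∙ s          ≲⟨ ⊙s∙s-mono s∈S (begin
                                U             ≈⟨ trans (sym (assoc _ _ y)) (∙-congʳ (sym star-w)) ⟩
                                star w ∙ y    ≲⟨ w*y≤xw ⟩
                                x ∙ w         ≈⟨ xw≈xw's ⟩
                                v ∙ s         ∎) ⟩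
        (v ∙ s) ⊙ s ∙ s    ≈⟨ ⊙s∙s-descent s∈S v-up ⟩
        v ∙ s ∙ s          ≈⟨ generator-cancelʳ s∈S v ⟩
        v                  ∎
      below-z : ∀ {Y} → Y ≤ᴮ z' → (star s ⊙ Y) ⊙ s ≤ᴮ z
      below-z Y≤z' = ≤ᴮ-respʳ (⊙s-mono s∈S (s⊙-mono (star-S s∈S) Y≤z')) (sym z≈)
      by-cases : U ⊙ s ∙ s ≈ U ⊎ U ⊙ s ∙ s ≈ U ∙ s → y ≤ᴮ z
      by-cases (inj₁ U⊙s∙s≈U) = begin
        y                     ≈⟨ sym (generator-cancelˡ (star-S s∈S) y) ⟩
        star s ∙ Y            ≲⟨ s∙≤ᴮs⊙ (star-S s∈S) Y ⟩
        star s ⊙ Y            ≲⟨ ≤ᴮ-⊙s s∈S _ ⟩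
        (star s ⊙ Y) ⊙ s      ≲⟨ below-z (IH Y (≤ᴮ-trans (bruhat-refl (sym U⊙s∙s≈U)) U⊙s∙s≤v)) ⟩
        z                     ∎
        where
        Y : Carrier
        Y = star s ∙ y
      by-cases (inj₂ U⊙s∙s≈Us) = begin
        y                     ≈⟨ solve (involution (star s) (S-invol (star-S s∈S)) ∷ᵥ plain y ∷ᵥ
                                   involution s (S-invol s∈S) ∷ᵥ []ᵥ) X₁ (X₀ ⊗ (X₀ ⊗ X₁ ⊗ X₂) ⊗ X₂) P.refl ⟩
        star s ∙ Y ∙ s        ≲⟨ ∙s≤ᴮ⊙s s∈S _ ⟩
        (star s ∙ Y) ⊙ s      ≲⟨ ⊙s-mono s∈S (s∙≤ᴮs⊙ (star-S s∈S) Y) ⟩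
        (star s ⊙ Y) ⊙ s      ≲⟨ below-z (IH Y (≤ᴮ-trans (bruhat-refl w'*Y≈) U⊙s∙s≤v)) ⟩
        z                     ∎
        where
        Y : Carrier
        Y = star s ∙ y ∙ s
        w'*Y≈ : star w' ∙ Y ≈ U ⊙ s ∙ s
        w'*Y≈ = trans (solve (plain (star w') ∷ᵥ plain (star s) ∷ᵥ plain y ∷ᵥ plain s ∷ᵥ []ᵥ)
          (X₀ ⊗ (X₁ ⊗ X₂ ⊗ X₃)) (X₀ ⊗ (X₁ ⊗ X₂) ⊗ X₃) P.refl) (sym U⊙s∙s≈Us)

    part-a : ∀ {z w} → Solution z w → PartA z w
    part-a = solution-induction PartA part-a-ε part-a-step

    PartB : Carrier → Carrier → Set
    PartB z w = ∀ y → star w ∙ z ≤ᴮ y ∙ w → x ≤ᴮ y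

    part-b-ε : ∀ {z w} → Solution z w → w ≈ ε → PartB z w
    part-b-ε {z} {w} w∈A w≈ε y w*z≤yw = above-act-ε (begin
        act ε           ≈⟨ trans (act-cong (sym w≈ε)) (InA.solves w∈A) ⟩
        z               ≈⟨ sym (star≈ε∙ w≈ε z) ⟩
        star w ∙ z      ≲⟨ w*z≤yw ⟩
        y ∙ w           ≈⟨ ∙≈ε w≈ε y ⟩
        y               ∎)
      where
      open PreorderReasoning bruhatPreorder
      above-act-ε : act ε ≤ᴮ y → x ≤ᴮ y
      above-act-ε act-ε≤y with ℓ x in ℓx
      ... | zero  = ≤ᴮ-trans (bruhat-refl (ℓ≡0⇒≈ε ℓx)) (ε-≤ᴮ y)
      ... | suc j = ≤ᴮ-trans (bruhat-refl (sym (act-ε≈x ℓx))) act-ε≤y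

    -- min(w* z, w* z s) = (w* z) ⊙ s ∙ s is u = w'* z', as u s is longer than u; by monotonicity
    -- of a ↦ min(a, a s) it lies below min(y w, y w s) ≤ y w s = y w'.
    part-b-step : ∀ {z w m} (sh : Shortening z w m) → let open Shortening sh in PartB (act w') w' → PartB z w
    part-b-step {z} {w} {m} sh IH y w*z≤yw = IH y u≤yw'
      where
      open Shortened sh
      u-up : suc (ℓ u) ≡ ℓ (u ∙ s)
      u-up = ≤-antisym (+-cancelˡ-≤ m _ _ (begin
        m + suc (ℓ u)               ≡⟨ P.trans (+-suc m (ℓ u)) (P.cong suc (+-comm m (ℓ u))) ⟩
        suc (ℓ u + m)               ≤⟨ s≤s (P.subst (λ k → ℓ u + k ≤ ℓ z') ℓw'≡m
                                         (proj₂ (solution-lengths w'∈A))) ⟩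
        suc (ℓ z')                  ≡⟨ z'-up ⟩
        ℓ (z' ∙ s)                  ≡⟨ ℓ-cong (solve (plain (star w') ∷ᵥ plain z' ∷ᵥ plain s ∷ᵥ []ᵥ)
                                          (X₁ ⊗ X₂) (inv X₀ ⊗ (X₀ ⊗ X₁ ⊗ X₂)) P.refl) ⟩
        ℓ (star w' ⁻¹ ∙ (u ∙ s))    ≤⟨ ℓ-∙ _ _ ⟩
        ℓ (star w' ⁻¹) + ℓ (u ∙ s)  ≡⟨ P.cong (_+ ℓ (u ∙ s)) (P.trans (ℓ-star⁻¹ w') ℓw'≡m) ⟩
        m + ℓ (u ∙ s)               ∎)) (ℓ-∙s s∈S u)
        where open ≤-Reasoning
      lower-w*z : (star w ∙ z) ⊙ s ∙ s ≈ u
      lower-w*z with w*z-shape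
      ... | inj₁ (w*z≈us , _) = trans (∙-congʳ (⊙-cong w*z≈us refl)) (trans (⊙s∙s-descent s∈S
              (P.trans (P.cong suc (ℓ-cong (generator-cancelʳ s∈S u))) u-up)) (generator-cancelʳ s∈S u))
      ... | inj₂ (w*z≈u , _)  = trans (∙-congʳ (⊙-cong w*z≈u refl)) (⊙s∙s-ascent s∈S u-up)
      u≤yw' : u ≤ᴮ y ∙ w'
      u≤yw' = begin
        u                       ≈⟨ sym lower-w*z ⟩
        (star w ∙ z) ⊙ s ∙ s    ≲⟨ ⊙s∙s-mono s∈S w*z≤yw ⟩
        (y ∙ w) ⊙ s ∙ s         ≲⟨ ⊙s∙s≤ᴮ∙s s∈S (y ∙ w) ⟩
        y ∙ w ∙ s               ≈⟨ trans (∙-congʳ (∙-congˡ w≈w's)) (trans (assoc _ _ s)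
                                     (∙-congˡ (generator-cancelʳ s∈S w'))) ⟩
        y ∙ w'                  ∎
        where open PreorderReasoning bruhatPreorder

    part-b : ∀ {z w} → Solution z w → PartB z w
    part-b = solution-induction PartB part-b-ε part-b-step

proposition4p7 : (T : TwistedCoxeterSystem) → let open TCS T in
    (ℓ : Carrier → ℕ) → IsLengthFunction ℓ →
    (_⊙_ : Carrier → Carrier → Carrier) → IsDemazureProduct ℓ _⊙_ →
    (x y z w : Carrier) → Twisted x → Twisted y → Twisted z →
    InA ℓ _⊙_ x z w →
    (Bruhat ℓ (star w ∙ y) (x ∙ w) → Bruhat ℓ y z)
    × (Bruhat ℓ (star w ∙ z) (y ∙ w) → Bruhat ℓ x y)
-- y and z need not be twisted involutions: z = x ⋉ w is one anyway (act-twisted).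
proposition4p7 T ℓ isLength _⊙_ isDemazure x y z w x-twisted _ _ w∈A = part-a w∈A y , part-b w∈A y
  where
  open TwistedInvolutions T ℓ isLength _⊙_ isDemazure
  open TwistedAction x x-twisted
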